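{- Let $X = \mathrm{Cay}(\mathbb{Z}_n, S)$ be a circulant graph, let $\alpha$ be an automorphism of $BX$, and let $s, t \in S$. Suppose $\alpha$ maps some $s$-edge of $BX$ to a $t$-edge, and that either $\gcd(|s|,|t|) = 1$, or $S$ contains every element that generates the subgroup $\langle s \rangle$ (which holds, e.g., if $|s| \in \{1,2,3,4,6\}$). Then $S$ contains every element that generates $\langle t \rangle$.
   Context: In this statement graphs may have loops (but no multiple edges). For $S \subseteq \mathbb{Z}_n$ with $-S = S$, $\mathrm{Cay}(\mathbb{Z}_n,S)$ has vertex set $\mathbb{Z}_n$ with $v \sim w$ iff $w - v \in S$. The canonical bipartite double cover is $BX = \mathrm{Cay}(\mathbb{Z}_n \times \mathbb{Z}_2, S \times \{1\})$, i.e., vertex set $\mathbb{Z}_n\times\{0,1\}$ with $(v,0)\sim(w,1)$ iff $w-v\in S$. For $s \in S$, an $s$-edge of $BX$ is an edge $\{u,v\}$ with $v = u \pm (s,1)$. For $x \in \mathbb{Z}_n$, $|x|$ denotes the order of $x$ in $\mathbb{Z}_n$. -}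

module Defs where

open import Level using (0ℓ)
open import Data.Nat using (ℕ; suc; _+_; _*_; _∸_; NonZero; _<_)
open import Data.Nat.DivMod using (_mod_)
open import Data.Nat.GCD using (gcd)
open import Data.Fin using (Fin; toℕ)
open import Data.Bool using (Bool; true; false; not)
open import Data.Product using (_×_; _,_; ∃; ∃-syntax; Σ)
open import Data.Sum using (_⊎_)
open import Function.Bundles using (_↔_; Inverse)
open import Relation.Binary.PropositionalEquality using (_≡_)
open import Relation.Unary using (Pred; _∈_)
open import Relation.Nullary using (¬_)

module _ {n : ℕ} .{{_ : NonZero n}} where

  infixl 6 _+ₙ_ _-ₙ_
  _+ₙ_ : Fin n → Fin n → Fin n
  a +ₙ b = (toℕ a + toℕ b) mod n

  -ₙ_ : Fin n → Fin n
  -ₙ a = (n ∸ toℕ a) mod n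

  _-ₙ_ : Fin n → Fin n → Fin n
  a -ₙ b = a +ₙ (-ₙ b)

  _·ₙ_ : ℕ → Fin n → Fin n
  k ·ₙ a = (k * toℕ a) mod n

  Symmetric : Pred (Fin n) 0ℓ → Set
  Symmetric S = ∀ x → x ∈ S → (-ₙ x) ∈ S

  IsOrder : Fin n → ℕ → Set
  IsOrder x k = (0 < k) × (k ·ₙ x ≡ 0 mod n)
              × (∀ j → 0 < j → j < k → ¬ (j ·ₙ x ≡ 0 mod n))

  InSubgroup : Fin n → Fin n → Set
  InSubgroup y x = ∃[ k ] (y ≡ k ·ₙ x)

  Generates : Fin n → Fin n → Set
  Generates y x = InSubgroup y x × InSubgroup x y

  ContainsAllGenerators : Pred (Fin n) 0ℓ → Fin n → Set
  ContainsAllGenerators S x = ∀ y → Generates y x → y ∈ S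

  -- Vertices of BX = Cay(Z_n × Z_2, S × {1}); Z_2 is represented by Bool (true = 1)
  BVertex : Set
  BVertex = Fin n × Bool

  BAdj : Pred (Fin n) 0ℓ → BVertex → BVertex → Set
  BAdj S (a , b) (c , d) = (d ≡ not b) × ((c -ₙ a) ∈ S)

  _⊕_ : BVertex → Fin n → BVertex
  (a , b) ⊕ s = (a +ₙ s , not b)

  _⊖_ : BVertex → Fin n → BVertex
  (a , b) ⊖ s = (a -ₙ s , not b)

  IsSEdge : Pred (Fin n) 0ℓ → Fin n → BVertex → BVertex → Set
  IsSEdge S s u v = BAdj S u v × ((v ≡ u ⊕ s) ⊎ (v ≡ u ⊖ s))

  record BAut (S : Pred (Fin n) 0ℓ) : Set where
    field
      perm     : BVertex ↔ BVertex
      preserve : ∀ u v → BAdj S u v → BAdj S (Inverse.to perm u) (Inverse.to perm v)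
      reflect  : ∀ u v → BAdj S (Inverse.to perm u) (Inverse.to perm v) → BAdj S u v

  apply : {S : Pred (Fin n) 0ℓ} → BAut S → BVertex → BVertex
  apply α = Inverse.to (BAut.perm α)

-- For an odd prime p coprime to n, the adjacency operator A of a Cayley graph on ℤₙ × ℤ₂
-- is a sum of commuting translations, so by the freshman's dream A^p ≡ A′ (mod p), where A′
-- is the adjacency operator for the connection set scaled by p (p odd keeps the ℤ₂-part 1).
-- An automorphism α of BX commutes with A, hence with A′ modulo p; as A′ is a 0/1 matrix
-- (p is a unit mod n), α is an automorphism of B Cay(ℤₙ, p·S), and so of B Cay(ℤₙ, m·S) for
-- every odd m coprime to n. Choose such an m with m·x₀ = s for some x₀ ∈ S and m·y = t for
-- the given generator y of ⟨t⟩ (x₀ = s via the Chinese remainder theorem, or x₀ = m⁻¹·s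
-- when S contains the generators of ⟨s⟩). The s-edge is an (m·x₀)-edge, so its image, a
-- t-edge, is an (m·x)-edge with x ∈ S, whence y = ±x ∈ S.

module Submission where

open import Defs
open import Level using (0ℓ)
open import Algebra.Bundles using (Semiring)
open import Data.Nat using (ℕ; NonZero)
open import Data.Fin using (Fin)
open import Data.List using (List)
open import Data.List.Relation.Unary.Unique.Propositional using (Unique)
open import Function using (_↔_)
open import Relation.Binary.PropositionalEquality using (_≡_)
open import Relation.Unary using (Pred)

module Arithmetic where
  open import Data.Nat
  open import Data.Nat.Properties
  open import Data.Nat.Divisibility
  open import Data.Nat.DivMod
  open import Data.Nat.Primality
  open import Data.Nat.Primality.Factorisation using (factorise)
  open import Data.Nat.Combinatorics using (_C_; nCk≡n!/k![n-k]!; k![n∸k]!∣n!)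
  open import Data.Nat.Coprimality using (Coprime; coprime-Bézout; coprime-divisor; coprime?)
  import Data.Nat.Coprimality as Coprimality
  open import Data.Nat.GCD using (module Bézout)
  open import Data.Nat.ListAction using (product)
  open import Data.Nat.Induction using (<-wellFounded)
  open import Induction.WellFounded using (Acc; acc)
  open import Data.List using ([]; _∷_)
  open import Data.List.Relation.Unary.All using (_∷_)
  open import Data.Product using (_×_; _,_; ∃)
  open import Data.Sum using (inj₁; inj₂)
  open import Data.Empty using (⊥; ⊥-elim)
  open import Function using (_∘_)
  open import Relation.Binary.PropositionalEquality
  open import Relation.Nullary using (¬_; yes; no; Dec; _×-dec_)

  prime∤factorial : ∀ {p} → Prime p → ∀ j → j < p → ¬ p ∣ j !
  prime∤factorial {p} pp zero j<p p∣1 = <⇒≱ (nonTrivial⇒n>1 p {{prime⇒nonTrivial pp}}) (∣⇒≤ p∣1)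
  prime∤factorial pp (suc j) j<p p∣j! with euclidsLemma (suc j) (j !) pp p∣j!
  ... | inj₁ p∣1+j = <⇒≱ j<p (∣⇒≤ p∣1+j)
  ... | inj₂ p∣j!  = prime∤factorial pp j (<-trans (n<1+n j) j<p) p∣j!

  prime∣binomial : ∀ {p} → Prime p → ∀ k → 0 < k → k < p → p ∣ p C k
  prime∣binomial {p} pp k 0<k k<p
    with euclidsLemma (p C k) (k ! * (p ∸ k) !) pp (subst (p ∣_) (sym C*k![p∸k]!≡p!) (p∣p! pp))
    where
      instance _ = k !* (p ∸ k) !≢0
      C*k![p∸k]!≡p! : (p C k) * (k ! * (p ∸ k) !) ≡ p !
      C*k![p∸k]!≡p! = trans (cong (_* (k ! * (p ∸ k) !)) (nCk≡n!/k![n-k]! (<⇒≤ k<p)))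
                            (m/n*n≡m (k![n∸k]!∣n! (<⇒≤ k<p)))
      p∣p! : ∀ {m} → Prime m → m ∣ m !
      p∣p! {suc m} _ = m∣m*n (m !)
  ... | inj₁ p∣C = p∣C
  ... | inj₂ p∣k!*[p∸k]! with euclidsLemma (k !) ((p ∸ k) !) pp p∣k!*[p∸k]!
  ...   | inj₁ p∣k! = ⊥-elim (prime∤factorial pp k k<p p∣k!)
  ...   | inj₂ p∣[p∸k]! = ⊥-elim (prime∤factorial pp (p ∸ k) (∸-monoʳ-< {p} {k} {0} 0<k (<⇒≤ k<p)) p∣[p∸k]!)

  [m%n+k]%n≡[m+k]%n : ∀ m k n .{{_ : NonZero n}} → (m % n + k) % n ≡ (m + k) % n
  [m%n+k]%n≡[m+k]%n m k n = begin
    (m % n + k) % n           ≡⟨ %-distribˡ-+ (m % n) k n ⟩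
    (m % n % n + k % n) % n   ≡⟨ cong (λ z → (z + k % n) % n) (m%n%n≡m%n m n) ⟩
    (m % n + k % n) % n       ≡⟨ sym (%-distribˡ-+ m k n) ⟩
    (m + k) % n               ∎
    where open ≡-Reasoning

  [k+m%n]%n≡[k+m]%n : ∀ k m n .{{_ : NonZero n}} → (k + m % n) % n ≡ (k + m) % n
  [k+m%n]%n≡[k+m]%n k m n = begin
    (k + m % n) % n ≡⟨ cong (_% n) (+-comm k (m % n)) ⟩
    (m % n + k) % n ≡⟨ [m%n+k]%n≡[m+k]%n m k n ⟩
    (m + k) % n     ≡⟨ cong (_% n) (+-comm m k) ⟩
    (k + m) % n     ∎
    where open ≡-Reasoning

  [k*[m%n]]%n≡[k*m]%n : ∀ k m n .{{_ : NonZero n}} → (k * (m % n)) % n ≡ (k * m) % n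
  [k*[m%n]]%n≡[k*m]%n k m n = begin
    (k * (m % n)) % n         ≡⟨ %-distribˡ-* k (m % n) n ⟩
    (k % n * (m % n % n)) % n ≡⟨ cong (λ z → (k % n * z) % n) (m%n%n≡m%n m n) ⟩
    (k % n * (m % n)) % n     ≡⟨ sym (%-distribˡ-* k m n) ⟩
    (k * m) % n               ∎
    where open ≡-Reasoning

  %≡%-∣ : ∀ {x y d N} .{{_ : NonZero d}} .{{_ : NonZero N}} → d ∣ N → x % N ≡ y % N → x % d ≡ y % d
  %≡%-∣ {x} {y} {d} {N} d∣N x≡y =
    trans (sym (m∣n⇒o%n%m≡o%m d N x d∣N)) (trans (cong (_% d) x≡y) (m∣n⇒o%n%m≡o%m d N y d∣N))

  ∃prime∣ : ∀ {i} → 2 ≤ i → ∃ λ q → Prime q × q ∣ i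
  ∃prime∣ {i} 2≤i with factorise i {{>-nonZero (<-trans (s≤s z≤n) 2≤i)}}
  ... | record { factors = [] ; isFactorisation = i≡1 } = ⊥-elim (<⇒≱ 2≤i (≤-reflexive i≡1))
  ... | record { factors = q ∷ qs ; isFactorisation = i≡q*qs ; factorsPrime = q-prime ∷ _ } =
    q , q-prime , subst (q ∣_) (sym i≡q*qs) (m∣m*n (product qs))

  no-common-prime⇒coprime : ∀ {a b} .{{_ : NonZero a}} →
                            (∀ q → Prime q → q ∣ a → q ∣ b → ⊥) → Coprime a b
  no-common-prime⇒coprime {a} noPrime {i} (i∣a , i∣b) with i ≟ 0 | i ≟ 1
  ... | yes refl | _      = ⊥-elim (≢-nonZero⁻¹ a (0∣⇒≡0 i∣a))
  ... | no _     | yes i≡1 = i≡1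
  ... | no i≢0   | no i≢1
    with ∃prime∣ (≤∧≢⇒< (≤∧≢⇒< z≤n (i≢0 ∘ sym)) (i≢1 ∘ sym))
  ...   | q , q-prime , q∣i = ⊥-elim (noPrime q q-prime (∣-trans q∣i i∣a) (∣-trans q∣i i∣b))

  prime∤⇒coprime : ∀ {q r} → Prime q → ¬ q ∣ r → Coprime q r
  prime∤⇒coprime {q} q-prime q∤r {i} (i∣q , i∣r) with prime⇒irreducible q-prime i∣q
  ... | inj₁ i≡1 = i≡1
  ... | inj₂ refl = ⊥-elim (q∤r i∣r)

  coprime-∣ˡ : ∀ {a b d} → Coprime a b → d ∣ a → Coprime d b
  coprime-∣ˡ a⊥b d∣a (i∣d , i∣b) = a⊥b (∣-trans i∣d d∣a , i∣b)

  coprime-∣ʳ : ∀ {a b d} → Coprime a b → d ∣ b → Coprime a d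
  coprime-∣ʳ a⊥b d∣b (i∣a , i∣d) = a⊥b (i∣a , ∣-trans i∣d d∣b)

  coprime-*ˡ : ∀ {a b c} → Coprime a c → Coprime b c → Coprime (a * b) c
  coprime-*ˡ {a} a⊥c b⊥c (i∣ab , i∣c) =
    b⊥c (coprime-divisor (λ (j∣i , j∣a) → a⊥c (j∣a , ∣-trans j∣i i∣c)) i∣ab , i∣c)

  coprime-*ʳ : ∀ {a b c} → Coprime a b → Coprime a c → Coprime a (b * c)
  coprime-*ʳ a⊥b a⊥c = Coprimality.sym (coprime-*ˡ (Coprimality.sym a⊥b) (Coprimality.sym a⊥c))

  coprime-%ˡ : ∀ {c c' d} .{{_ : NonZero d}} → c % d ≡ c' % d → Coprime c' d → Coprime c d
  coprime-%ˡ {c} c≡c' c'⊥d (i∣c , i∣d) =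
    c'⊥d (∣n∣m%n⇒∣m i∣d (subst (_ ∣_) c≡c' (%-presˡ-∣ i∣c i∣d)) , i∣d)

  coprime-∣-* : ∀ {a b m} → Coprime a b → a ∣ m → b ∣ m → a * b ∣ m
  coprime-∣-* {a} {b} a⊥b (divides e m≡e*a) b∣m
    with coprime-divisor (Coprimality.sym a⊥b) (subst (b ∣_) (trans m≡e*a (*-comm e a)) b∣m)
  ... | divides f refl = divides f (trans m≡e*a (trans (*-assoc f b a) (cong (f *_) (*-comm b a))))

  prime-∤-∣-* : ∀ {q r m} → Prime q → ¬ q ∣ r → q ∣ m → r ∣ m → q * r ∣ m
  prime-∤-∣-* {q} {r} q-prime q∤r q∣m (divides e m≡e*r) with euclidsLemma e r q-prime (subst (q ∣_) m≡e*r q∣m)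
  ... | inj₁ (divides f refl) = divides f (trans m≡e*r (*-assoc f q r))
  ... | inj₂ q∣r = ⊥-elim (q∤r q∣r)

  least-positive : (P : ℕ → Set) → (∀ k → Dec (P k)) → ∀ N → 0 < N → P N →
                   ∃ λ k → 0 < k × P k × (∀ j → 0 < j → j < k → ¬ P j)
  least-positive P P? N = go (<-wellFounded N)
    where
      go : ∀ {N} → Acc _<_ N → 0 < N → P N → ∃ λ k → 0 < k × P k × (∀ j → 0 < j → j < k → ¬ P j)
      go {N} (acc smaller) 0<N PN with anyUpTo? (λ j → (0 <? j) ×-dec P? j) N
      ... | yes (j , j<N , 0<j , Pj) = go (smaller j<N) 0<j Pj
      ... | no none = N , 0<N , PN , λ j 0<j j<N Pj → none (j , j<N , 0<j , Pj)

  greatest-≤ : (P : ℕ → Set) → (∀ k → Dec (P k)) → ∀ N → (∃ λ k → k ≤ N × P k) →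
               ∃ λ k → k ≤ N × P k × (∀ j → j ≤ N → P j → j ≤ k)
  greatest-≤ P P? zero (k , k≤0 , Pk) = k , k≤0 , Pk , (λ j j≤0 _ → ≤-trans j≤0 z≤n)
  greatest-≤ P P? (suc N) (k , k≤1+N , Pk) with P? (suc N)
  ... | yes P[1+N] = suc N , ≤-refl , P[1+N] , (λ j j≤1+N _ → j≤1+N)
  ... | no ¬P[1+N] with greatest-≤ P P? N (k , below k≤1+N Pk , Pk)
    where
      below : ∀ {j} → j ≤ suc N → P j → j ≤ N
      below j≤1+N Pj with m≤n⇒m<n∨m≡n j≤1+N
      ... | inj₁ j<1+N = s≤s⁻¹ j<1+N
      ... | inj₂ refl  = ⊥-elim (¬P[1+N] Pj)
  ...   | g , g≤N , Pg , greatest = g , m≤n⇒m≤1+n g≤N , Pg , greatest′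
    where
      greatest′ : ∀ j → j ≤ suc N → P j → j ≤ g
      greatest′ j j≤1+N Pj with m≤n⇒m<n∨m≡n j≤1+N
      ... | inj₁ j<1+N = greatest j (s≤s⁻¹ j<1+N) Pj
      ... | inj₂ refl  = ⊥-elim (¬P[1+N] Pj)

  -- m = c + d R, with R the largest divisor of N coprime to c, shares no prime with N.
  coprime-lift : ∀ N c d .{{_ : NonZero N}} .{{_ : NonZero d}} → d ∣ N → Coprime c d →
                 ∃ λ m → m % d ≡ c % d × Coprime N m
  coprime-lift N c d d∣N c⊥d
    with greatest-≤ (λ k → k ∣ N × Coprime k c) (λ k → (k ∣? N) ×-dec (coprime? k c)) N
                    (1 , >-nonZero⁻¹ N , 1∣ N , (λ (i∣1 , _) → ∣1⇒≡1 i∣1))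
  ... | R , _ , (R∣N , R⊥c) , R-greatest = c + d * R , m%d≡c%d , no-common-prime⇒coprime noPrime
    where
      m%d≡c%d : (c + d * R) % d ≡ c % d
      m%d≡c%d = trans (cong (λ x → (c + x) % d) (*-comm d R)) ([m+kn]%n≡m%n c R d)
      q≢1 : ∀ {q} → Prime q → q ≢ 1
      q≢1 q-prime refl = <⇒≱ (nonTrivial⇒n>1 1 {{prime⇒nonTrivial q-prime}}) ≤-refl
      noPrime : ∀ q → Prime q → q ∣ N → q ∣ c + d * R → ⊥
      noPrime q q-prime q∣N q∣m with q ∣? c
      ... | yes q∣c with euclidsLemma d R q-prime (∣m+n∣m⇒∣n q∣m q∣c)
      ...   | inj₁ q∣d = q≢1 q-prime (c⊥d (q∣c , q∣d))
      ...   | inj₂ q∣R = q≢1 q-prime (R⊥c (q∣R , q∣c))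
      noPrime q q-prime q∣N q∣m | no q∤c with q ∣? R
      ... | yes q∣R = q∤c (∣m+n∣m⇒∣n (subst (q ∣_) (+-comm c (d * R)) q∣m) (∣n⇒∣m*n d q∣R))
      ... | no q∤R =
        <⇒≱ R<qR (R-greatest (q * R) (∣⇒≤ qR∣N) (qR∣N , coprime-*ˡ (prime∤⇒coprime q-prime q∤c) R⊥c))
        where
          qR∣N : q * R ∣ N
          qR∣N = prime-∤-∣-* q-prime q∤R q∣N R∣N
          R<qR : R < q * R
          R<qR = subst (_< q * R) (*-identityˡ R)
                   (*-monoˡ-< R {{≢-nonZero (λ { refl → ≢-nonZero⁻¹ N (0∣⇒≡0 R∣N) })}}
                     (nonTrivial⇒n>1 q {{prime⇒nonTrivial q-prime}}))

  -- Lifting modulo 2 N also makes m odd.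
  odd-coprime-lift : ∀ N c d .{{_ : NonZero N}} .{{_ : NonZero d}} → d ∣ N → Coprime c d →
                     ∃ λ m → m % d ≡ c % d × ¬ 2 ∣ m × Coprime N m
  odd-coprime-lift N c d d∣N c⊥d with coprime-lift (2 * N) c d {{m*n≢0 2 N}} (∣-trans d∣N (n∣m*n 2)) c⊥d
  ... | m , m≡c , 2N⊥m =
    m , m≡c , (λ 2∣m → <⇒≱ (s≤s ≤-refl) (≤-reflexive (2N⊥m (m∣m*n N , 2∣m)))) , coprime-∣ˡ 2N⊥m (n∣m*n 2)

  mod-inverse : ∀ a N .{{_ : NonZero N}} → Coprime a N → ∃ λ w → (a * w) % N ≡ 1 % N
  mod-inverse a N a⊥N with coprime-Bézout a⊥N
  ... | Bézout.+- x y 1+yN≡xa = x , (begin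
    (a * x) % N     ≡⟨ cong (_% N) (trans (*-comm a x) (sym 1+yN≡xa)) ⟩
    (1 + y * N) % N ≡⟨ [m+kn]%n≡m%n 1 y N ⟩
    1 % N           ∎)
    where open ≡-Reasoning
  ... | Bézout.-+ x y 1+xa≡yN = x * (N ∸ 1) , (begin
    (a * (x * (N ∸ 1))) % N         ≡⟨ cong (_% N) (sym (*-assoc a x (N ∸ 1))) ⟩
    (a * x * (N ∸ 1)) % N           ≡⟨ sym ([m+kn]%n≡m%n (a * x * (N ∸ 1)) y N) ⟩
    (a * x * (N ∸ 1) + y * N) % N   ≡⟨ cong (_% N) (+-comm (a * x * (N ∸ 1)) (y * N)) ⟩
    (y * N + a * x * (N ∸ 1)) % N   ≡⟨ cong (λ z → (z + a * x * (N ∸ 1)) % N) (sym 1+xa≡yN) ⟩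
    (1 + x * a + a * x * (N ∸ 1)) % N ≡⟨ cong (_% N) (regroup (x * a) (a * x) (*-comm x a)) ⟩
    (1 + a * x * N) % N             ≡⟨ [m+kn]%n≡m%n 1 (a * x) N ⟩
    1 % N                           ∎)
    where
      open ≡-Reasoning
      regroup : ∀ u v → u ≡ v → 1 + u + v * (N ∸ 1) ≡ 1 + v * N
      regroup u v refl = begin
        1 + u + u * (N ∸ 1)   ≡⟨ +-assoc 1 u _ ⟩
        1 + (u + u * (N ∸ 1)) ≡⟨ cong (1 +_) (sym (*-suc u (N ∸ 1))) ⟩
        1 + u * suc (N ∸ 1)   ≡⟨ cong (λ z → 1 + u * z) (suc-pred N) ⟩
        1 + u * N             ∎

  -- The solution is c = a + k w (b + (l ∸ 1) a), where w inverts k modulo l.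
  chinese-remainder : ∀ a b k l .{{_ : NonZero k}} .{{_ : NonZero l}} → Coprime k l →
                      ∃ λ c → c % k ≡ a % k × c % l ≡ b % l
  chinese-remainder a b k l k⊥l with mod-inverse k l k⊥l
  ... | w , kw≡1 = a + k * (w * B) , c%k≡a%k , c%l≡b%l
    where
      open ≡-Reasoning
      B : ℕ
      B = b + (l ∸ 1) * a
      c%k≡a%k : (a + k * (w * B)) % k ≡ a % k
      c%k≡a%k = trans (cong (λ z → (a + z) % k) (*-comm k (w * B))) ([m+kn]%n≡m%n a (w * B) k)
      c%l≡b%l : (a + k * (w * B)) % l ≡ b % l
      c%l≡b%l = begin
        (a + k * (w * B)) % l             ≡⟨ cong (λ z → (a + z) % l) (sym (*-assoc k w B)) ⟩
        (a + k * w * B) % l               ≡⟨ %-distribˡ-+ a (k * w * B) l ⟩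
        (a % l + (k * w * B) % l) % l     ≡⟨ cong (λ z → (a % l + z) % l) (%-distribˡ-* (k * w) B l) ⟩
        (a % l + (k * w) % l * (B % l) % l) % l ≡⟨ cong (λ z → (a % l + z * (B % l) % l) % l) kw≡1 ⟩
        (a % l + 1 % l * (B % l) % l) % l ≡⟨ cong (λ z → (a % l + z) % l) (sym (%-distribˡ-* 1 B l)) ⟩
        (a % l + (1 * B) % l) % l         ≡⟨ sym (%-distribˡ-+ a (1 * B) l) ⟩
        (a + 1 * B) % l                   ≡⟨ cong (_% l) regroup ⟩
        (b + a * l) % l                   ≡⟨ [m+kn]%n≡m%n b a l ⟩
        b % l                             ∎
        where
          regroup : a + 1 * B ≡ b + a * l
          regroup = begin
            a + 1 * (b + (l ∸ 1) * a) ≡⟨ cong (a +_) (*-identityˡ B) ⟩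
            a + (b + (l ∸ 1) * a)     ≡⟨ +-comm a B ⟩
            b + (l ∸ 1) * a + a       ≡⟨ +-assoc b _ a ⟩
            b + ((l ∸ 1) * a + a)     ≡⟨ cong (b +_) (+-comm ((l ∸ 1) * a) a) ⟩
            b + suc (l ∸ 1) * a       ≡⟨ cong (λ z → b + z * a) (suc-pred l) ⟩
            b + l * a                 ≡⟨ cong (b +_) (*-comm l a) ⟩
            b + a * l                 ∎

module FreshmansDream {c ℓ} (R : Semiring c ℓ) where
  open import Data.Nat as Nat using (ℕ; zero; suc; _<_; s≤s; z≤n)
  import Data.Nat.Properties as ℕₚ
  open import Data.Nat.Divisibility using (_∣_; module _∣_)
  open import Data.Nat.Primality using (Prime)
  open import Data.Nat.Combinatorics using (_C_; nCn≡1)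
  open import Data.Fin using (Fin; zero; suc; toℕ; fromℕ; inject₁)
  open import Data.Fin.Properties using (toℕ-fromℕ; toℕ-inject₁; toℕ<n)
  open import Data.Product using (_,_; ∃)
  open import Function using (_∘_)
  open import Relation.Binary.PropositionalEquality as ≡ using (_≡_)
  open Arithmetic using (prime∣binomial)

  open Semiring R hiding (zero)
  open import Algebra.Properties.Semiring.Sum R using (sum; sum-cong-≋; sum-init-last)
  open import Algebra.Properties.Semiring.Mult R using (_×_; ×-assocˡ; ×-homo-1)
  open import Algebra.Properties.CommutativeMonoid.Mult +-commutativeMonoid using (×-distrib-+)
  open import Algebra.Properties.Semiring.Exp R using (_^_)
  import Algebra.Properties.Semiring.Binomial R as Binomial
  open import Relation.Binary.Reasoning.Setoid setoid

  ×-zeroʳ : ∀ k → k × 0# ≈ 0#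
  ×-zeroʳ zero = refl
  ×-zeroʳ (suc k) = trans (+-identityˡ (k × 0#)) (×-zeroʳ k)

  ×-distrib-sum : ∀ k {m} (w : Fin m → Carrier) → sum (λ i → k × w i) ≈ k × sum w
  ×-distrib-sum k {zero} w = sym (×-zeroʳ k)
  ×-distrib-sum k {suc m} w = trans (+-congˡ (×-distrib-sum k (w ∘ suc))) (sym (×-distrib-+ (w zero) (sum (w ∘ suc)) k))

  -- The middle binomial coefficients are divisible by p.
  freshmans-dream : ∀ {p} → Prime p → ∀ x y → x * y ≈ y * x →
                    ∃ λ z → (x + y) ^ p ≈ x ^ p + y ^ p + p × z
  freshmans-dream {suc q} p-prime x y x*y≈y*x = z , (begin
    (x + y) ^ p                          ≈⟨ theorem x*y≈y*x p ⟩
    binomialExpansion p                  ≈⟨ +-congˡ (sum-init-last (binomialTerm p ∘ suc)) ⟩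
    term 0F + (sum middle + term (fromℕ p)) ≈⟨ +-cong first (+-cong (sum-cong-≋ middle≈) last) ⟩
    y ^ p + (sum (λ i → p × w i) + x ^ p) ≈⟨ +-congˡ (+-congʳ (×-distrib-sum p w)) ⟩
    y ^ p + (p × z + x ^ p)              ≈⟨ rearrange ⟩
    x ^ p + y ^ p + p × z                ∎)
    where
      open Binomial x y using (binomial; binomialTerm; binomialExpansion; theorem)
      p : ℕ
      p = suc q
      term : Fin (suc p) → Carrier
      term = binomialTerm p
      0F : Fin (suc p)
      0F = zero
      p∣C : ∀ i → p ∣ p C suc (toℕ (inject₁ i))
      p∣C i = prime∣binomial p-prime _ (s≤s z≤n) (s≤s (≡.subst (_< q) (≡.sym (toℕ-inject₁ i)) (toℕ<n i)))
      middle : Fin q → Carrier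
      middle i = term (suc (inject₁ i))
      coefficient : Fin q → ℕ
      coefficient i = _∣_.quotient (p∣C i)
      w : Fin q → Carrier
      w i = coefficient i × binomial p (suc (inject₁ i))
      z : Carrier
      z = sum w
      middle≈ : ∀ i → middle i ≈ p × w i
      middle≈ i = begin
        (p C suc (toℕ (inject₁ i))) × b ≡⟨ ≡.cong (_× b) (_∣_.equality (p∣C i)) ⟩
        (coefficient i Nat.* p) × b       ≡⟨ ≡.cong (_× b) (ℕₚ.*-comm (coefficient i) p) ⟩
        (p Nat.* coefficient i) × b       ≈⟨ ×-assocˡ b p (coefficient i) ⟨
        p × w i                         ∎
        where
          b : Carrier
          b = binomial p (suc (inject₁ i))
      first : term 0F ≈ y ^ p
      first = trans (×-homo-1 (1# * y ^ p)) (*-identityˡ (y ^ p))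
      last : term (fromℕ p) ≈ x ^ p
      last = begin
        (p C toℕ (fromℕ p)) × (x ^ toℕ (fromℕ p) * y ^ (p Nat.∸ toℕ (fromℕ p)))
          ≡⟨ ≡.cong (λ k → (p C k) × (x ^ k * y ^ (p Nat.∸ k))) (toℕ-fromℕ p) ⟩
        (p C p) × (x ^ p * y ^ (p Nat.∸ p))
          ≡⟨ ≡.cong₂ (λ c k → c × (x ^ p * y ^ k)) (nCn≡1 p) (ℕₚ.n∸n≡0 p) ⟩
        1 × (x ^ p * 1#) ≈⟨ ×-homo-1 (x ^ p * 1#) ⟩
        x ^ p * 1#       ≈⟨ *-identityʳ (x ^ p) ⟩
        x ^ p            ∎
      rearrange : y ^ p + (p × z + x ^ p) ≈ x ^ p + y ^ p + p × z
      rearrange = begin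
        y ^ p + (p × z + x ^ p) ≈⟨ +-congˡ (+-comm (p × z) (x ^ p)) ⟩
        y ^ p + (x ^ p + p × z) ≈⟨ +-assoc (y ^ p) (x ^ p) (p × z) ⟨
        y ^ p + x ^ p + p × z   ≈⟨ +-congʳ (+-comm (y ^ p) (x ^ p)) ⟩
        x ^ p + y ^ p + p × z   ∎

module AdditiveOperators (V : Set) where
  open import Level using (0ℓ)
  open import Data.Nat as Nat using (ℕ)
  import Data.Nat.Properties as ℕₚ
  open import Data.Product using (_,_)
  open import Relation.Binary.PropositionalEquality as ≡ using (_≡_)

  open Nat using (_+_)
  open import Algebra.Properties.CommutativeSemigroup ℕₚ.+-commutativeSemigroup
    using () renaming (interchange to +-interchange)

  record Operator : Set where
    field
      act      : (V → ℕ) → V → ℕ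
      act-cong : ∀ {f g} → (∀ v → f v ≡ g v) → ∀ v → act f v ≡ act g v
      act-+    : ∀ f g v → act (λ w → f w + g w) v ≡ act f v + act g v
  open Operator public

  infix 4 _≈ᵒ_
  infixl 6 _+ᵒ_
  infixl 7 _*ᵒ_

  _≈ᵒ_ : Operator → Operator → Set
  A ≈ᵒ B = ∀ f v → act A f v ≡ act B f v

  act-0 : ∀ A v → act A (λ _ → 0) v ≡ 0
  act-0 A v = ℕₚ.+-cancelˡ-≡ a a 0 (≡.trans (≡.sym (act-+ A (λ _ → 0) (λ _ → 0) v)) (≡.sym (ℕₚ.+-identityʳ a)))
    where
      a : ℕ
      a = act A (λ _ → 0) v

  _+ᵒ_ : Operator → Operator → Operator
  A +ᵒ B = record
    { act      = λ f v → act A f v + act B f v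
    ; act-cong = λ f≗g v → ≡.cong₂ _+_ (act-cong A f≗g v) (act-cong B f≗g v)
    ; act-+    = λ f g v → ≡.trans (≡.cong₂ _+_ (act-+ A f g v) (act-+ B f g v))
                                   (+-interchange (act A f v) (act A g v) (act B f v) (act B g v)) }

  _*ᵒ_ : Operator → Operator → Operator
  A *ᵒ B = record
    { act      = λ f → act A (act B f)
    ; act-cong = λ f≗g → act-cong A (act-cong B f≗g)
    ; act-+    = λ f g v → ≡.trans (act-cong A (act-+ B f g) v) (act-+ A (act B f) (act B g) v) }

  0ᵒ : Operator
  0ᵒ = record { act = λ _ _ → 0 ; act-cong = λ _ _ → ≡.refl ; act-+ = λ _ _ _ → ≡.refl }

  1ᵒ : Operator
  1ᵒ = record { act = λ f → f ; act-cong = λ f≗g → f≗g ; act-+ = λ _ _ _ → ≡.refl }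

  operatorSemiring : Semiring 0ℓ 0ℓ
  operatorSemiring = record
    { Carrier = Operator ; _≈_ = _≈ᵒ_ ; _+_ = _+ᵒ_ ; _*_ = _*ᵒ_ ; 0# = 0ᵒ ; 1# = 1ᵒ
    ; isSemiring = record
      { isSemiringWithoutAnnihilatingZero = record
        { +-isCommutativeMonoid = record
          { isMonoid = record
            { isSemigroup = record
              { isMagma = record
                { isEquivalence = record
                  { refl  = λ _ _ → ≡.refl
                  ; sym   = λ A≈B f v → ≡.sym (A≈B f v)
                  ; trans = λ A≈B B≈C f v → ≡.trans (A≈B f v) (B≈C f v) }
                ; ∙-cong = λ A≈B C≈D f v → ≡.cong₂ _+_ (A≈B f v) (C≈D f v) }
              ; assoc = λ A B D f v → ℕₚ.+-assoc (act A f v) (act B f v) (act D f v) }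
            ; identity = (λ _ _ _ → ≡.refl) , (λ A f v → ℕₚ.+-identityʳ (act A f v)) }
          ; comm = λ A B f v → ℕₚ.+-comm (act A f v) (act B f v) }
        ; *-cong = λ {A} {A′} {B} {B′} A≈A′ B≈B′ f v → ≡.trans (act-cong A (B≈B′ f) v) (A≈A′ (act B′ f) v)
        ; *-assoc = λ _ _ _ _ _ → ≡.refl
        ; *-identity = (λ _ _ _ → ≡.refl) , (λ _ _ _ → ≡.refl)
        ; distrib = (λ A B D f v → act-+ A (act B f) (act D f) v) , (λ _ _ _ _ _ → ≡.refl) }
      ; zero = (λ _ _ _ → ≡.refl) , (λ A f v → act-0 A v) } }

module Translations {V G : Set} (_⊕_ : V → G → V) (⊕-comm : ∀ v y z → (v ⊕ y) ⊕ z ≡ (v ⊕ z) ⊕ y) where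
  open import Data.Nat as Nat using (zero; suc)
  import Data.Nat.Properties as ℕₚ
  open import Data.Nat.DivMod using (_%_; [m+kn]%n≡m%n)
  open import Data.Nat.GeneralisedArithmetic using (iterate)
  open import Data.Nat.ListAction using (sum)
  open import Data.Nat.Primality using (Prime)
  open import Data.List using (List; []; _∷_; map)
  open import Data.Product using (_,_)
  open import Relation.Binary.PropositionalEquality as ≡ using (_≡_)
  open Arithmetic using ([k+m%n]%n≡[k+m]%n)
  open FreshmansDream using (freshmans-dream)

  open AdditiveOperators V
  open import Algebra.Properties.Semiring.Exp operatorSemiring using (_^_)
  open import Algebra.Properties.Semiring.Mult operatorSemiring using (_×_)
  open Nat using (_+_; _*_)
  open ≡ using (refl; cong; cong₂; trans; sym)

  τ : G → Operator
  τ y = record { act = λ f v → f (v ⊕ y) ; act-cong = λ f≗g v → f≗g (v ⊕ y) ; act-+ = λ _ _ _ → refl }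

  Στ : List G → Operator
  Στ []       = 0ᵒ
  Στ (y ∷ ys) = τ y +ᵒ Στ ys

  act-Στ : ∀ ys f v → act (Στ ys) f v ≡ sum (map (λ y → f (v ⊕ y)) ys)
  act-Στ []       f v = refl
  act-Στ (y ∷ ys) f v = cong (f (v ⊕ y) +_) (act-Στ ys f v)

  act-τ^ : ∀ k y f v → act (τ y ^ k) f v ≡ f (iterate (_⊕ y) v k)
  act-τ^ zero    y f v = refl
  act-τ^ (suc k) y f v = act-τ^ k y f (v ⊕ y)

  act-× : ∀ k A f v → act (k × A) f v ≡ k * act A f v
  act-× zero    A f v = refl
  act-× (suc k) A f v = cong (act A f v +_) (act-× k A f v)

  τ-Στ-comm : ∀ y ys → τ y *ᵒ Στ ys ≈ᵒ Στ ys *ᵒ τ y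
  τ-Στ-comm y []       f v = refl
  τ-Στ-comm y (z ∷ zs) f v = cong₂ _+_ (cong f (⊕-comm v y z)) (τ-Στ-comm y zs f v)

  Στ-frobenius : ∀ {p} .{{_ : Nat.NonZero p}} → Prime p →
                 (scale : G → G) → (∀ y v → iterate (_⊕ y) v p ≡ v ⊕ scale y) →
                 ∀ ys f v → act (Στ ys ^ p) f v % p ≡ act (Στ (map scale ys)) f v % p
  Στ-frobenius {zero}  ()      scale iterate-p ys       f v
  Στ-frobenius {suc q} p-prime scale iterate-p []       f v = refl
  Στ-frobenius {p} p-prime scale iterate-p (y ∷ ys) f v
    with freshmans-dream operatorSemiring p-prime (τ y) (Στ ys) (τ-Στ-comm y ys)
  ... | z , expand = begin
    act ((τ y +ᵒ Στ ys) ^ p) f v % p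
      ≡⟨ cong (_% p) (expand f v) ⟩
    (act (τ y ^ p) f v + act (Στ ys ^ p) f v + act (p × z) f v) % p
      ≡⟨ cong (λ k → (_ + k) % p) (trans (act-× p z f v) (ℕₚ.*-comm p _)) ⟩
    (act (τ y ^ p) f v + act (Στ ys ^ p) f v + act z f v * p) % p
      ≡⟨ [m+kn]%n≡m%n _ (act z f v) p ⟩
    (act (τ y ^ p) f v + act (Στ ys ^ p) f v) % p
      ≡⟨ cong (λ k → (k + _) % p) (trans (act-τ^ p y f v) (cong f (iterate-p y v))) ⟩
    (f (v ⊕ scale y) + act (Στ ys ^ p) f v) % p
      ≡⟨ sym ([k+m%n]%n≡[k+m]%n _ _ p) ⟩
    (f (v ⊕ scale y) + act (Στ ys ^ p) f v % p) % p
      ≡⟨ cong (λ k → (f (v ⊕ scale y) + k) % p) (Στ-frobenius p-prime scale iterate-p ys f v) ⟩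
    (f (v ⊕ scale y) + act (Στ (map scale ys)) f v % p) % p
      ≡⟨ [k+m%n]%n≡[k+m]%n _ _ p ⟩
    (f (v ⊕ scale y) + act (Στ (map scale ys)) f v) % p ∎
    where
      open ≡.≡-Reasoning

module IntegersModulo where
  open import Level using (0ℓ)
  open import Algebra.Bundles using (AbelianGroup)
  import Algebra.Properties.AbelianGroup as AbelianGroupProperties
  open import Data.Nat hiding (_^_)
  open import Data.Nat.Properties
  open import Data.Nat.Divisibility
  open import Data.Nat.DivMod
  open import Data.Nat.Coprimality using (Coprime; coprime-divisor)
  open import Data.Fin using (Fin; toℕ) renaming (_≟_ to _≟ᶠ_)
  open import Data.Fin.Properties using (toℕ-injective; toℕ-fromℕ<; toℕ<n)
  open import Data.Product using (_,_; ∃)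
  open import Data.Empty using (⊥-elim)
  open import Relation.Binary.PropositionalEquality
  open import Relation.Nullary using (yes; no)
  open Arithmetic using ([m%n+k]%n≡[m+k]%n; [k+m%n]%n≡[k+m]%n; [k*[m%n]]%n≡[k*m]%n; least-positive)

  module _ {n : ℕ} .{{_ : NonZero n}} where

    0ₙ : Fin n
    0ₙ = 0 mod n

    toℕ-mod : ∀ x → toℕ (x mod n) ≡ x % n
    toℕ-mod x = toℕ-fromℕ< _

    mod-toℕ : ∀ (a : Fin n) → toℕ a mod n ≡ a
    mod-toℕ a = toℕ-injective (trans (toℕ-mod (toℕ a)) (m<n⇒m%n≡m (toℕ<n a)))

    mod-cong : ∀ {x y} → x % n ≡ y % n → x mod n ≡ y mod n
    mod-cong {x} {y} x≡y = toℕ-injective (trans (toℕ-mod x) (trans x≡y (sym (toℕ-mod y))))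

    0%n≡0 : 0 % n ≡ 0
    0%n≡0 = m<n⇒m%n≡m (>-nonZero⁻¹ n)

    toℕ-0ₙ : toℕ 0ₙ ≡ 0
    toℕ-0ₙ = trans (toℕ-mod 0) 0%n≡0

    mod-+ₙ : ∀ x (b : Fin n) → (x mod n) +ₙ b ≡ (x + toℕ b) mod n
    mod-+ₙ x b = mod-cong (trans (cong (λ z → (z + toℕ b) % n) (toℕ-mod x)) ([m%n+k]%n≡[m+k]%n x (toℕ b) n))

    +ₙ-mod : ∀ (a : Fin n) y → a +ₙ (y mod n) ≡ (toℕ a + y) mod n
    +ₙ-mod a y = mod-cong (trans (cong (λ z → (toℕ a + z) % n) (toℕ-mod y)) ([k+m%n]%n≡[k+m]%n (toℕ a) y n))

    ·ₙ-mod : ∀ k x → k ·ₙ (x mod n) ≡ (k * x) mod n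
    ·ₙ-mod k x = mod-cong (trans (cong (λ z → (k * z) % n) (toℕ-mod x)) ([k*[m%n]]%n≡[k*m]%n k x n))

    mod-+ₙ-mod : ∀ x y → (x mod n) +ₙ (y mod n) ≡ (x + y) mod n
    mod-+ₙ-mod x y = trans (mod-+ₙ x (y mod n))
      (mod-cong (trans (cong (λ z → (x + z) % n) (toℕ-mod y)) ([k+m%n]%n≡[k+m]%n x y n)))

    +ₙ-assoc : ∀ (a b c : Fin n) → (a +ₙ b) +ₙ c ≡ a +ₙ (b +ₙ c)
    +ₙ-assoc a b c = trans (mod-+ₙ (toℕ a + toℕ b) c)
      (trans (cong (_mod n) (+-assoc (toℕ a) (toℕ b) (toℕ c))) (sym (+ₙ-mod a (toℕ b + toℕ c))))

    +ₙ-comm : ∀ (a b : Fin n) → a +ₙ b ≡ b +ₙ a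
    +ₙ-comm a b = cong (_mod n) (+-comm (toℕ a) (toℕ b))

    +ₙ-identityˡ : ∀ (a : Fin n) → 0ₙ +ₙ a ≡ a
    +ₙ-identityˡ a = trans (mod-+ₙ 0 a) (mod-toℕ a)

    +ₙ-identityʳ : ∀ (a : Fin n) → a +ₙ 0ₙ ≡ a
    +ₙ-identityʳ a = trans (+ₙ-comm a 0ₙ) (+ₙ-identityˡ a)

    -ₙ-inverseˡ : ∀ (a : Fin n) → (-ₙ a) +ₙ a ≡ 0ₙ
    -ₙ-inverseˡ a = trans (mod-+ₙ (n ∸ toℕ a) a)
      (mod-cong (trans (cong (_% n) (m∸n+n≡m (<⇒≤ (toℕ<n a)))) (trans (n%n≡0 n) (sym 0%n≡0))))

    ℤₙ : AbelianGroup 0ℓ 0ℓ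
    ℤₙ = record
      { Carrier = Fin n
      ; _≈_ = _≡_
      ; _∙_ = _+ₙ_
      ; ε = 0ₙ
      ; _⁻¹ = λ a → -ₙ a
      ; isAbelianGroup = record
        { isGroup = record
          { isMonoid = record
            { isSemigroup = record
              { isMagma = record { isEquivalence = isEquivalence ; ∙-cong = cong₂ _+ₙ_ }
              ; assoc = +ₙ-assoc }
            ; identity = +ₙ-identityˡ , +ₙ-identityʳ }
          ; inverse = -ₙ-inverseˡ , (λ a → trans (+ₙ-comm a (-ₙ a)) (-ₙ-inverseˡ a))
          ; ⁻¹-cong = cong (λ a → -ₙ a) }
        ; comm = +ₙ-comm } }

    open AbelianGroupProperties ℤₙ public
      using (inverseˡ-unique; ⁻¹-involutive; x∙y⁻¹≈ε⇒x≈y; xyx⁻¹≈y; ∙-cancelˡ; ∙-cancelʳ)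

    ·ₙ-distribˡ : ∀ k (a b : Fin n) → k ·ₙ (a +ₙ b) ≡ k ·ₙ a +ₙ k ·ₙ b
    ·ₙ-distribˡ k a b = trans (·ₙ-mod k (toℕ a + toℕ b))
      (trans (cong (_mod n) (*-distribˡ-+ k (toℕ a) (toℕ b))) (sym (mod-+ₙ-mod (k * toℕ a) (k * toℕ b))))

    ·ₙ-distribʳ : ∀ j k (a : Fin n) → (j + k) ·ₙ a ≡ j ·ₙ a +ₙ k ·ₙ a
    ·ₙ-distribʳ j k a = trans (cong (_mod n) (*-distribʳ-+ (toℕ a) j k)) (sym (mod-+ₙ-mod (j * toℕ a) (k * toℕ a)))

    ·ₙ-assoc : ∀ j k (a : Fin n) → j ·ₙ (k ·ₙ a) ≡ (j * k) ·ₙ a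
    ·ₙ-assoc j k a = trans (·ₙ-mod j (k * toℕ a)) (cong (_mod n) (sym (*-assoc j k (toℕ a))))

    ·ₙ-identityˡ : ∀ (a : Fin n) → 1 ·ₙ a ≡ a
    ·ₙ-identityˡ a = trans (cong (_mod n) (*-identityˡ (toℕ a))) (mod-toℕ a)

    ·ₙ-zeroʳ : ∀ k → k ·ₙ 0ₙ ≡ 0ₙ
    ·ₙ-zeroʳ k = trans (·ₙ-mod k 0) (cong (_mod n) (*-zeroʳ k))

    ·ₙ-neg : ∀ k (a : Fin n) → k ·ₙ (-ₙ a) ≡ -ₙ (k ·ₙ a)
    ·ₙ-neg k a = inverseˡ-unique (k ·ₙ (-ₙ a)) (k ·ₙ a)
      (trans (sym (·ₙ-distribˡ k (-ₙ a) a)) (trans (cong (k ·ₙ_) (-ₙ-inverseˡ a)) (·ₙ-zeroʳ k)))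

    n·ₙ≡0ₙ : ∀ (a : Fin n) → n ·ₙ a ≡ 0ₙ
    n·ₙ≡0ₙ a = mod-cong (trans (cong (_% n) (*-comm n (toℕ a))) (trans (m*n%n≡0 (toℕ a) n) (sym 0%n≡0)))

    ·ₙ≡0ₙ⇒∣ : ∀ k (a : Fin n) → k ·ₙ a ≡ 0ₙ → n ∣ k * toℕ a
    ·ₙ≡0ₙ⇒∣ k a ka≡0 = m%n≡0⇒n∣m _ n (trans (sym (toℕ-mod (k * toℕ a))) (trans (cong toℕ ka≡0) toℕ-0ₙ))

    ·ₙ-% : ∀ d .{{_ : NonZero d}} (a : Fin n) → d ·ₙ a ≡ 0ₙ → ∀ j → j ·ₙ a ≡ (j % d) ·ₙ a
    ·ₙ-% d a da≡0 j = begin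
      j ·ₙ a                                ≡⟨ cong (_·ₙ a) (m≡m%n+[m/n]*n j d) ⟩
      (j % d + j / d * d) ·ₙ a              ≡⟨ ·ₙ-distribʳ (j % d) (j / d * d) a ⟩
      (j % d) ·ₙ a +ₙ (j / d * d) ·ₙ a      ≡⟨ cong ((j % d) ·ₙ a +ₙ_) (sym (·ₙ-assoc (j / d) d a)) ⟩
      (j % d) ·ₙ a +ₙ (j / d) ·ₙ (d ·ₙ a)   ≡⟨ cong (λ z → (j % d) ·ₙ a +ₙ (j / d) ·ₙ z) da≡0 ⟩
      (j % d) ·ₙ a +ₙ (j / d) ·ₙ 0ₙ         ≡⟨ cong ((j % d) ·ₙ a +ₙ_) (·ₙ-zeroʳ (j / d)) ⟩
      (j % d) ·ₙ a +ₙ 0ₙ                    ≡⟨ +ₙ-identityʳ _ ⟩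
      (j % d) ·ₙ a                          ∎
      where open ≡-Reasoning

    ·ₙ-cong-mod : ∀ d .{{_ : NonZero d}} (a : Fin n) → d ·ₙ a ≡ 0ₙ →
                  ∀ {j k} → j % d ≡ k % d → j ·ₙ a ≡ k ·ₙ a
    ·ₙ-cong-mod d a da≡0 {j} {k} j≡k = trans (·ₙ-% d a da≡0 j) (trans (cong (_·ₙ a) j≡k) (sym (·ₙ-% d a da≡0 k)))

    ·ₙ-injective : ∀ {m} → Coprime n m → ∀ (a b : Fin n) → m ·ₙ a ≡ m ·ₙ b → a ≡ b
    ·ₙ-injective {m} n⊥m a b ma≡mb =
      x∙y⁻¹≈ε⇒x≈y a b (toℕ≡0 (coprime-divisor n⊥m (·ₙ≡0ₙ⇒∣ m (a -ₙ b) m[a-b]≡0)))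
      where
        m[a-b]≡0 : m ·ₙ (a -ₙ b) ≡ 0ₙ
        m[a-b]≡0 = begin
          m ·ₙ (a -ₙ b)               ≡⟨ ·ₙ-distribˡ m a (-ₙ b) ⟩
          m ·ₙ a +ₙ m ·ₙ (-ₙ b)       ≡⟨ cong₂ (λ x y → x +ₙ y) ma≡mb (·ₙ-neg m b) ⟩
          m ·ₙ b +ₙ (-ₙ (m ·ₙ b))     ≡⟨ trans (+ₙ-comm (m ·ₙ b) (-ₙ (m ·ₙ b))) (-ₙ-inverseˡ (m ·ₙ b)) ⟩
          0ₙ                          ∎
          where open ≡-Reasoning
        toℕ≡0 : ∀ {c : Fin n} → n ∣ toℕ c → c ≡ 0ₙ
        toℕ≡0 {c} n∣c = trans (sym (mod-toℕ c)) (mod-cong (trans (n∣m⇒m%n≡0 _ n n∣c) (sym 0%n≡0)))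

    order-exists : ∀ (x : Fin n) → ∃ (IsOrder x)
    order-exists x = least-positive (λ j → j ·ₙ x ≡ 0ₙ) (λ j → j ·ₙ x ≟ᶠ 0ₙ) n (>-nonZero⁻¹ n) (n·ₙ≡0ₙ x)

    order-∣ : ∀ {x : Fin n} {k} → IsOrder x k → ∀ j → j ·ₙ x ≡ 0ₙ → k ∣ j
    order-∣ {x} {k} (0<k , kx≡0 , least) j jx≡0 = m%n≡0⇒n∣m j k j%k≡0
      where
        instance
          k≢0 : NonZero k
          k≢0 = >-nonZero 0<k
        j%k≡0 : j % k ≡ 0
        j%k≡0 with j % k ≟ 0
        ... | yes j%k≡0 = j%k≡0
        ... | no j%k≢0 = ⊥-elim (least (j % k) (n≢0⇒n>0 j%k≢0) (m%n<n j k) (trans (sym (·ₙ-% k x kx≡0 j)) jx≡0))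

    order-∣n : ∀ {x : Fin n} {k} → IsOrder x k → k ∣ n
    order-∣n {x} o = order-∣ o n (n·ₙ≡0ₙ x)

    order-∣-∸ : ∀ {x : Fin n} {d} → IsOrder x d → ∀ {j k} → k ≤ j → j ·ₙ x ≡ k ·ₙ x → d ∣ j ∸ k
    order-∣-∸ {x} o {j} {k} k≤j jx≡kx = order-∣ o (j ∸ k) (∙-cancelʳ (k ·ₙ x) ((j ∸ k) ·ₙ x) 0ₙ (begin
      (j ∸ k) ·ₙ x +ₙ k ·ₙ x ≡⟨ sym (·ₙ-distribʳ (j ∸ k) k x) ⟩
      (j ∸ k + k) ·ₙ x       ≡⟨ cong (_·ₙ x) (m∸n+n≡m k≤j) ⟩
      j ·ₙ x                 ≡⟨ jx≡kx ⟩
      k ·ₙ x                 ≡⟨ sym (+ₙ-identityˡ (k ·ₙ x)) ⟩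
      0ₙ +ₙ k ·ₙ x           ∎))
      where open ≡-Reasoning

module DoubleCover where
  open import Data.Nat using (ℕ; zero; suc; NonZero)
  open import Data.Nat.Divisibility using (_∣_; divides; ∣-refl; ∣m∣n⇒∣m+n)
  open import Data.Nat.GeneralisedArithmetic using (iterate)
  open import Data.Bool using (not)
  open import Data.Bool.Properties using (not-involutive)
  open import Data.Product using (_,_; proj₁; proj₂)
  open import Data.Empty using (⊥-elim)
  open import Relation.Binary.PropositionalEquality
  open import Relation.Nullary using (¬_)
  open IntegersModulo

  iterate-not-odd : ∀ k → ¬ 2 ∣ k → ∀ b → iterate not b k ≡ not b
  iterate-not-odd zero odd b = ⊥-elim (odd (divides 0 refl))
  iterate-not-odd (suc zero) odd b = refl
  iterate-not-odd (suc (suc k)) odd b =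
    trans (cong (λ c → iterate not c k) (not-involutive b))
          (iterate-not-odd k (λ 2∣k → odd (∣m∣n⇒∣m+n (∣-refl {2}) 2∣k)) b)

  module _ {n : ℕ} .{{_ : NonZero n}} where

    ⊕-comm : ∀ (v : BVertex {n}) y z → (v ⊕ y) ⊕ z ≡ (v ⊕ z) ⊕ y
    ⊕-comm (a , b) y z = cong (_, not (not b)) (begin
      (a +ₙ y) +ₙ z ≡⟨ +ₙ-assoc a y z ⟩
      a +ₙ (y +ₙ z) ≡⟨ cong (a +ₙ_) (+ₙ-comm y z) ⟩
      a +ₙ (z +ₙ y) ≡⟨ sym (+ₙ-assoc a z y) ⟩
      (a +ₙ z) +ₙ y ∎)
      where open ≡-Reasoning

    ⊕-cancelˡ : ∀ (v : BVertex {n}) y z → v ⊕ y ≡ v ⊕ z → y ≡ z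
    ⊕-cancelˡ (a , b) y z v⊕y≡v⊕z = ∙-cancelˡ a y z (cong proj₁ v⊕y≡v⊕z)

    iterate-⊕ : ∀ y k (v : BVertex {n}) → iterate (_⊕ y) v k ≡ (proj₁ v +ₙ k ·ₙ y , iterate not (proj₂ v) k)
    iterate-⊕ y zero (a , b) = cong (_, b) (sym (+ₙ-identityʳ a))
    iterate-⊕ y (suc k) (a , b) = trans (iterate-⊕ y k (a +ₙ y , not b)) (cong (_, iterate not (not b) k) (begin
      (a +ₙ y) +ₙ k ·ₙ y      ≡⟨ +ₙ-assoc a y (k ·ₙ y) ⟩
      a +ₙ (y +ₙ k ·ₙ y)      ≡⟨ cong (λ z → a +ₙ (z +ₙ k ·ₙ y)) (sym (·ₙ-identityˡ y)) ⟩
      a +ₙ (1 ·ₙ y +ₙ k ·ₙ y) ≡⟨ cong (a +ₙ_) (sym (·ₙ-distribʳ 1 k y)) ⟩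
      a +ₙ suc k ·ₙ y         ∎))
      where open ≡-Reasoning

    iterate-⊕-odd : ∀ y k → ¬ 2 ∣ k → ∀ (v : BVertex {n}) → iterate (_⊕ y) v k ≡ v ⊕ (k ·ₙ y)
    iterate-⊕-odd y k odd (a , b) = trans (iterate-⊕ y k (a , b)) (cong (a +ₙ k ·ₙ y ,_) (iterate-not-odd k odd b))

module FiniteClosure {n : ℕ} (succs : Fin n → List (Fin n)) where
  open import Data.Nat using (zero; suc; _≤_; s≤s; z≤n)
  open import Data.Nat.Properties using (≤-trans; <⇒≱; ≤-refl)
  open import Data.Bool using (true)
  open import Data.Fin.Properties using (any?)
  open import Data.Fin.Subset using (Subset; _∪_; _⊆_; ∣_∣) renaming (_∈_ to _∈ˢ_)
  open import Data.Fin.Subset.Properties using (_∈?_; x∈p∪q⁻; x∈p∪q⁺; p⊆p∪q; ∣p∣≤n; p⊂q⇒∣p∣<∣q∣)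
  open import Data.Vec using (tabulate)
  open import Data.Vec.Properties using (lookup∘tabulate; []=⇒lookup; lookup⇒[]=)
  open import Data.List using (filter; allFin)
  open import Data.List.Membership.Propositional using (_∈_)
  open import Data.List.Membership.Propositional.Properties using (∈-filter⁺; ∈-filter⁻; ∈-allFin)
  open import Data.List.Membership.DecPropositional (Data.Fin._≟_ {n}) using () renaming (_∈?_ to _∈ₗ?_)
  open import Data.List.Relation.Unary.Unique.Propositional using (Unique)
  open import Data.List.Relation.Unary.Unique.Propositional.Properties using (filter⁺; allFin⁺)
  open import Data.Product using (_×_; _,_; proj₁; proj₂; ∃)
  open import Data.Sum using (_⊎_; inj₁; inj₂)
  open import Data.Empty using (⊥-elim)
  open import Function using (_∘_; _⇔_; mk⇔)
  open import Function.Bundles using (Equivalence)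
  open import Relation.Binary.PropositionalEquality
  open import Relation.Nullary using (yes; no; Dec; does; _×-dec_; ¬?)
  open import Relation.Nullary.Decidable using (dec-true)
  open import Relation.Unary using (Pred; Decidable)

  does-true : ∀ {A : Set} (A? : Dec A) → does A? ≡ true → A
  does-true (yes a) _ = a
  does-true (no _) ()

  ∈-tabulate-does : ∀ {P : Pred (Fin n) _} (P? : Decidable P) x → x ∈ˢ tabulate (does ∘ P?) ⇔ P x
  ∈-tabulate-does P? x = mk⇔
    (λ x∈ → does-true (P? x) (trans (sym (lookup∘tabulate (does ∘ P?) x)) ([]=⇒lookup x∈)))
    (λ Px → lookup⇒[]= x (tabulate (does ∘ P?)) (trans (lookup∘tabulate (does ∘ P?) x) (dec-true (P? x) Px)))

  Step : Subset n → Fin n → Fin n → Set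
  Step R d′ d = d ∈ˢ R × d′ ∈ succs d

  successors : Subset n → Subset n
  successors R = tabulate (does ∘ λ d′ → any? (λ d → (d ∈? R) ×-dec (d′ ∈ₗ? succs d)))

  ∈-successors : ∀ R d′ → d′ ∈ˢ successors R ⇔ ∃ (Step R d′)
  ∈-successors R = ∈-tabulate-does (λ d′ → any? (λ d → (d ∈? R) ×-dec (d′ ∈ₗ? succs d)))

  stage : Subset n → ℕ → Subset n
  stage R zero    = R
  stage R (suc k) = stage R k ∪ successors (stage R k)

  -- Until it stabilises, each stage adds an element, so it stabilises within n steps.
  stage-grows : ∀ R k → (∃ λ j → successors (stage R j) ⊆ stage R j) ⊎ k ≤ ∣ stage R k ∣
  stage-grows R zero = inj₂ z≤n
  stage-grows R (suc k) with stage-grows R k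
  ... | inj₁ stable = inj₁ stable
  ... | inj₂ k≤∣Rₖ∣ with any? (λ x → (x ∈? successors (stage R k)) ×-dec ¬? (x ∈? stage R k))
  ...   | yes (x , x∈new , x∉Rₖ) =
    inj₂ (≤-trans (s≤s k≤∣Rₖ∣) (p⊂q⇒∣p∣<∣q∣ (p⊆p∪q _ , x , x∈p∪q⁺ (inj₂ x∈new) , x∉Rₖ)))
  ...   | no nothing-new = inj₁ (k , λ {x} x∈new → dec-stable x x∈new)
    where
      dec-stable : ∀ x → x ∈ˢ successors (stage R k) → x ∈ˢ stage R k
      dec-stable x x∈new with x ∈? stage R k
      ... | yes x∈Rₖ = x∈Rₖ
      ... | no x∉Rₖ = ⊥-elim (nothing-new (x , x∈new , x∉Rₖ))

  stabilises : ∀ R → ∃ λ j → successors (stage R j) ⊆ stage R j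
  stabilises R with stage-grows R (suc n)
  ... | inj₁ stable = stable
  ... | inj₂ 1+n≤∣R∣ = ⊥-elim (<⇒≱ (s≤s ≤-refl) (≤-trans 1+n≤∣R∣ (∣p∣≤n (stage R (suc n)))))

  closure : Subset n → Subset n
  closure R = stage R (proj₁ (stabilises R))

  closure-closed : ∀ R {d d′} → d ∈ˢ closure R → d′ ∈ succs d → d′ ∈ˢ closure R
  closure-closed R d∈ d′∈ = proj₂ (stabilises R) (Equivalence.from (∈-successors _ _) (_ , d∈ , d′∈))

  ⊆-closure : ∀ R → R ⊆ closure R
  ⊆-closure R = go (proj₁ (stabilises R))
    where
      go : ∀ k → R ⊆ stage R k
      go zero    x∈R = x∈R
      go (suc k) x∈R = p⊆p∪q _ (go k x∈R)

  closure-least : ∀ R (P : Fin n → Set) → (∀ {x} → x ∈ˢ R → P x) →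
                  (∀ {d d′} → P d → d′ ∈ succs d → P d′) → ∀ {x} → x ∈ˢ closure R → P x
  closure-least R P P-R P-step = go (proj₁ (stabilises R))
    where
      go : ∀ k {x} → x ∈ˢ stage R k → P x
      go zero x∈ = P-R x∈
      go (suc k) {x} x∈ with x∈p∪q⁻ (stage R k) _ x∈
      ... | inj₁ x∈Rₖ = go k x∈Rₖ
      ... | inj₂ x∈new with Equivalence.to (∈-successors _ x) x∈new
      ...   | d , d∈Rₖ , x∈succs = P-step (go k d∈Rₖ) x∈succs

  elements : Subset n → List (Fin n)
  elements R = filter (_∈? R) (allFin n)

  elements-unique : ∀ R → Unique (elements R)
  elements-unique R = filter⁺ (_∈? R) (allFin⁺ n)

  ∈-elements : ∀ R {x} → x ∈ elements R ⇔ x ∈ˢ R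
  ∈-elements R {x} = mk⇔ (proj₂ ∘ ∈-filter⁻ (_∈? R) {xs = allFin n}) (∈-filter⁺ (_∈? R) (∈-allFin x))

module Indicator where
  open import Data.Nat using (ℕ; _+_; _≤_; NonZero; >-nonZero⁻¹)
  open import Data.Nat.DivMod using (_%_; m<n⇒m%n≡m)
  open import Data.Nat.ListAction using (sum)
  open import Data.List using ([]; _∷_; map)
  open import Data.List.Membership.Propositional using (_∈_)
  open import Data.List.Relation.Unary.Any using (here; there)
  open import Data.List.Relation.Unary.Unique.Propositional using (Unique)
  open import Data.List.Relation.Unary.Unique.Propositional.Properties using (Unique[x∷xs]⇒x∉xs)
  open import Data.List.Relation.Unary.AllPairs using ([]; _∷_)
  open import Data.Empty using (⊥-elim)
  open import Function using (_⇔_; mk⇔)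
  open import Function.Bundles using (Equivalence)
  open import Relation.Binary.PropositionalEquality
  open import Relation.Binary.Definitions using (DecidableEquality)
  open import Relation.Nullary using (¬_; Dec; yes; no)

  𝟙 : ∀ {A : Set} → Dec A → ℕ
  𝟙 (yes _) = 1
  𝟙 (no _)  = 0

  𝟙-yes : ∀ {A : Set} → A → (A? : Dec A) → 𝟙 A? ≡ 1
  𝟙-yes a (yes _) = refl
  𝟙-yes a (no ¬a) = ⊥-elim (¬a a)

  𝟙-no : ∀ {A : Set} → ¬ A → (A? : Dec A) → 𝟙 A? ≡ 0
  𝟙-no ¬a (yes a) = ⊥-elim (¬a a)
  𝟙-no ¬a (no _)  = refl

  𝟙-cong : ∀ {A B : Set} → A ⇔ B → (A? : Dec A) (B? : Dec B) → 𝟙 A? ≡ 𝟙 B?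
  𝟙-cong A⇔B (yes _) (yes _) = refl
  𝟙-cong A⇔B (no _)  (no _)  = refl
  𝟙-cong A⇔B (yes a) (no ¬b) = ⊥-elim (¬b (Equivalence.to A⇔B a))
  𝟙-cong A⇔B (no ¬a) (yes b) = ⊥-elim (¬a (Equivalence.from A⇔B b))

  𝟙-%-reflects : ∀ {A B : Set} {p} .{{_ : NonZero p}} → 2 ≤ p → (A? : Dec A) (B? : Dec B) →
                 𝟙 A? % p ≡ 𝟙 B? % p → A → B
  𝟙-%-reflects 2≤p A?      (yes b) _ _ = b
  𝟙-%-reflects 2≤p (no ¬a) (no _)  _ a = ⊥-elim (¬a a)
  𝟙-%-reflects {p = p} 2≤p (yes _) (no _) 1≡0 _
    with () ← trans (sym (m<n⇒m%n≡m 2≤p)) (trans 1≡0 (m<n⇒m%n≡m {m = 0} (>-nonZero⁻¹ p)))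

  module _ {A : Set} (_≟_ : DecidableEquality A) where
    open import Data.List.Membership.DecPropositional _≟_ using (_∈?_)

    sum-𝟙 : ∀ w {zs} → Unique zs → sum (map (λ z → 𝟙 (z ≟ w)) zs) ≡ 𝟙 (w ∈? zs)
    sum-𝟙 w {[]} [] = refl
    sum-𝟙 w {z ∷ zs} (z∉zs ∷ zs-unique) with z ≟ w
    ... | yes refl = begin
      1 + sum (map (λ z → 𝟙 (z ≟ w)) zs) ≡⟨ cong (1 +_) (sum-𝟙 w zs-unique) ⟩
      1 + 𝟙 (w ∈? zs)
        ≡⟨ cong (1 +_) (𝟙-no (Unique[x∷xs]⇒x∉xs (z∉zs ∷ zs-unique)) (w ∈? zs)) ⟩
      1                                  ≡⟨ sym (𝟙-yes (here refl) (w ∈? (w ∷ zs))) ⟩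
      𝟙 (w ∈? (w ∷ zs))                  ∎
      where open ≡-Reasoning
    ... | no z≢w = trans (sum-𝟙 w zs-unique) (𝟙-cong (mk⇔ there w∈z∷zs⇒w∈zs) (w ∈? zs) (w ∈? (z ∷ zs)))
      where
        w∈z∷zs⇒w∈zs : w ∈ z ∷ zs → w ∈ zs
        w∈z∷zs⇒w∈zs (here w≡z) = ⊥-elim (z≢w (sym w≡z))
        w∈z∷zs⇒w∈zs (there w∈zs) = w∈zs

module ScaledCayley {n : ℕ} .{{_ : NonZero n}} (L : List (Fin n)) (L-unique : Unique L)
                    (α : BVertex {n} ↔ BVertex {n}) where
  open import Data.Nat hiding (_^_)
  open import Data.Nat.Divisibility using (_∣_; ∣-trans; m∣m*n; n∣m*n; divides)
  open import Data.Nat.DivMod using (_%_)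
  open import Data.Nat.Coprimality using (Coprime)
  open import Data.Nat.Primality using (Prime; prime⇒nonZero; prime⇒nonTrivial)
  open import Data.Nat.Primality.Factorisation using (factorise)
  open import Data.Nat.ListAction using (sum; product)
  open import Data.Nat.ListAction.Properties using (sum-↭)
  open import Data.Bool using () renaming (_≟_ to _≟ᵇ_)
  open import Data.Fin using () renaming (_≟_ to _≟ᶠ_)
  open import Data.List using ([]; _∷_; map)
  open import Data.List.Properties using (map-∘; map-cong)
  open import Data.List.Membership.Propositional using (_∈_)
  open import Data.List.Membership.Propositional.Properties using (∈-map⁺; ∈-map⁻)
  open import Data.List.Membership.Propositional.Properties.WithK using (unique∧set⇒bag)
  open import Data.List.Relation.Unary.All using (All; []; _∷_)
  open import Data.List.Relation.Unary.Unique.Propositional.Properties using (map⁺)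
  open import Data.List.Relation.Binary.BagAndSetEquality using (∼bag⇒↭)
  open import Data.List.Relation.Binary.Permutation.Propositional using (_↭_)
  import Data.List.Relation.Binary.Permutation.Propositional.Properties as ↭
  open import Data.Product using (_×_; _,_; ∃)
  open import Data.Product.Properties using (≡-dec)
  open import Data.Empty using (⊥-elim)
  open import Function using (_∘_; _⇔_; mk⇔; Inverse)
  open import Function.Bundles using (Equivalence)
  open import Relation.Binary.PropositionalEquality
  open import Relation.Binary.Definitions using (DecidableEquality)
  open import Relation.Nullary using (¬_)
  open Arithmetic using (coprime-*ʳ; coprime-∣ʳ)
  open IntegersModulo
  open DoubleCover
  open Indicator
  open Inverse α using (to; from; strictlyInverseˡ; strictlyInverseʳ)
  open AdditiveOperators (BVertex {n}) using (act; act-cong)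
  open Translations _⊕_ ⊕-comm
  open import Algebra.Properties.Semiring.Exp (AdditiveOperators.operatorSemiring (BVertex {n})) using (_^_)

  private
    V : Set
    V = BVertex {n}

  _≟ⱽ_ : DecidableEquality V
  _≟ⱽ_ = ≡-dec _≟ᶠ_ _≟ᵇ_
  open import Data.List.Membership.DecPropositional _≟ⱽ_ using (_∈?_)

  to-injective : ∀ {u v} → to u ≡ to v → u ≡ v
  to-injective {u} {v} tu≡tv = trans (sym (strictlyInverseʳ u)) (trans (cong from tu≡tv) (strictlyInverseʳ v))

  Adj : ℕ → V → V → Set
  Adj m u w = ∃ λ x → x ∈ L × w ≡ u ⊕ (m ·ₙ x)

  IsAutomorphism : ℕ → Set
  IsAutomorphism m = ∀ u w → Adj m u w ⇔ Adj m (to u) (to w)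

  scaled : ℕ → List (Fin n)
  scaled m = map (m ·ₙ_) L

  neighbours : ℕ → V → List V
  neighbours m u = map (u ⊕_) (scaled m)

  ∈-neighbours : ∀ m u {z} → z ∈ neighbours m u ⇔ Adj m u z
  ∈-neighbours m u = mk⇔ to-Adj
    (λ (x , x∈L , z≡) → subst (_∈ neighbours m u) (sym z≡) (∈-map⁺ (u ⊕_) (∈-map⁺ (m ·ₙ_) x∈L)))
    where
      to-Adj : ∀ {z} → z ∈ neighbours m u → Adj m u z
      to-Adj z∈ with ∈-map⁻ (u ⊕_) z∈
      ... | y , y∈ , refl with ∈-map⁻ (m ·ₙ_) y∈
      ...   | x , x∈L , refl = x , x∈L , refl

  neighbours-unique : ∀ {m} → Coprime n m → ∀ u → Unique (neighbours m u)
  neighbours-unique n⊥m u = map⁺ (⊕-cancelˡ u _ _) (map⁺ (·ₙ-injective n⊥m _ _) L-unique)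

  adjacency : ℕ → AdditiveOperators.Operator V
  adjacency m = Στ (scaled m)

  act-adjacency : ∀ m f v → act (adjacency m) f v ≡ sum (map f (neighbours m v))
  act-adjacency m f v = trans (act-Στ (scaled m) f v) (cong sum (map-∘ (scaled m)))

  adjacency-commutes : ∀ {m} → Coprime n m → IsAutomorphism m → ∀ f v →
                       act (adjacency m) (f ∘ to) v ≡ act (adjacency m) f (to v)
  adjacency-commutes {m} n⊥m aut f v = begin
    act (adjacency m) (f ∘ to) v         ≡⟨ act-adjacency m (f ∘ to) v ⟩
    sum (map (f ∘ to) (neighbours m v))  ≡⟨ cong sum (map-∘ (neighbours m v)) ⟩
    sum (map f (map to (neighbours m v))) ≡⟨ sum-↭ (↭.map⁺ f image↭) ⟩
    sum (map f (neighbours m (to v)))    ≡⟨ sym (act-adjacency m f (to v)) ⟩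
    act (adjacency m) f (to v)           ∎
    where
      open ≡-Reasoning
      image⇔ : ∀ {z} → z ∈ map to (neighbours m v) ⇔ z ∈ neighbours m (to v)
      image⇔ {z} = mk⇔ image⇒ image⇐
        where
          image⇒ : z ∈ map to (neighbours m v) → z ∈ neighbours m (to v)
          image⇒ z∈ with ∈-map⁻ to z∈
          ... | z′ , z′∈ , refl = Equivalence.from (∈-neighbours m (to v))
                                    (Equivalence.to (aut v z′) (Equivalence.to (∈-neighbours m v) z′∈))
          image⇐ : z ∈ neighbours m (to v) → z ∈ map to (neighbours m v)
          image⇐ z∈ = subst (_∈ map to (neighbours m v)) (strictlyInverseˡ z)
            (∈-map⁺ to (Equivalence.from (∈-neighbours m v)
              (Equivalence.from (aut v (from z))
                (subst (Adj m (to v)) (sym (strictlyInverseˡ z)) (Equivalence.to (∈-neighbours m (to v)) z∈)))))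
      image↭ : map to (neighbours m v) ↭ neighbours m (to v)
      image↭ = ∼bag⇒↭ (unique∧set⇒bag (map⁺ to-injective (neighbours-unique n⊥m v))
                                      (neighbours-unique n⊥m (to v)) image⇔)

  adjacency^-commutes : ∀ {m} → Coprime n m → IsAutomorphism m → ∀ k f v →
                        act (adjacency m ^ k) (f ∘ to) v ≡ act (adjacency m ^ k) f (to v)
  adjacency^-commutes n⊥m aut zero    f v = refl
  adjacency^-commutes {m} n⊥m aut (suc k) f v =
    trans (act-cong (adjacency m) (adjacency^-commutes n⊥m aut k f) v)
          (adjacency-commutes n⊥m aut (act (adjacency m ^ k) f) v)

  δ : V → V → ℕ
  δ w z = 𝟙 (z ≟ⱽ w)

  act-adjacency-δ : ∀ {m} → Coprime n m → ∀ w u → act (adjacency m) (δ w) u ≡ 𝟙 (w ∈? neighbours m u)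
  act-adjacency-δ {m} n⊥m w u = trans (act-adjacency m (δ w) u) (sum-𝟙 _≟ⱽ_ w (neighbours-unique n⊥m u))

  -- The number of (p·L)-edges from u to w is congruent mod p to the number of p-step L-walks.
  isAutomorphism-prime-* : ∀ {p m} → Prime p → ¬ 2 ∣ p → Coprime n p → Coprime n m →
                           IsAutomorphism m → IsAutomorphism (p * m)
  isAutomorphism-prime-* {p} {m} p-prime p-odd n⊥p n⊥m aut u w =
    mk⇔ (edge-transfer count-invariant) (edge-transfer (sym count-invariant))
    where
      instance
        p≢0 : NonZero p
        p≢0 = prime⇒nonZero p-prime
      2≤p : 2 ≤ p
      2≤p = nonTrivial⇒n>1 p {{prime⇒nonTrivial p-prime}}
      n⊥pm : Coprime n (p * m)
      n⊥pm = coprime-*ʳ n⊥p n⊥m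
      frobenius : ∀ f v → act (adjacency m ^ p) f v % p ≡ act (adjacency (p * m)) f v % p
      frobenius f v = trans (Στ-frobenius p-prime (p ·ₙ_) (λ y → iterate-⊕-odd y p p-odd) (scaled m) f v)
        (cong (λ ys → act (Στ ys) f v % p) (trans (sym (map-∘ L)) (map-cong (·ₙ-assoc p m) L)))
      δ-to : ∀ z → δ (to w) (to z) ≡ δ w z
      δ-to z = 𝟙-cong (mk⇔ to-injective (cong to)) (to z ≟ⱽ to w) (z ≟ⱽ w)
      count-invariant : 𝟙 (w ∈? neighbours (p * m) u) % p ≡ 𝟙 (to w ∈? neighbours (p * m) (to u)) % p
      count-invariant = begin
        𝟙 (w ∈? neighbours (p * m) u) % p                    ≡⟨ cong (_% p) (sym (act-adjacency-δ n⊥pm w u)) ⟩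
        act (adjacency (p * m)) (δ w) u % p                   ≡⟨ sym (frobenius (δ w) u) ⟩
        act (adjacency m ^ p) (δ w) u % p                     ≡⟨ cong (_% p) (act-cong (adjacency m ^ p) (sym ∘ δ-to) u) ⟩
        act (adjacency m ^ p) (δ (to w) ∘ to) u % p           ≡⟨ cong (_% p) (adjacency^-commutes n⊥m aut p (δ (to w)) u) ⟩
        act (adjacency m ^ p) (δ (to w)) (to u) % p           ≡⟨ frobenius (δ (to w)) (to u) ⟩
        act (adjacency (p * m)) (δ (to w)) (to u) % p         ≡⟨ cong (_% p) (act-adjacency-δ n⊥pm (to w) (to u)) ⟩
        𝟙 (to w ∈? neighbours (p * m) (to u)) % p            ∎
        where open ≡-Reasoning
      edge-transfer : ∀ {u′ w′ u″ w″} →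
                      𝟙 (w′ ∈? neighbours (p * m) u′) % p ≡ 𝟙 (w″ ∈? neighbours (p * m) u″) % p →
                      Adj (p * m) u′ w′ → Adj (p * m) u″ w″
      edge-transfer {u′} {w′} {u″} {w″} counts adj =
        Equivalence.to (∈-neighbours (p * m) u″)
          (𝟙-%-reflects 2≤p (w′ ∈? _) (w″ ∈? _) counts (Equivalence.from (∈-neighbours (p * m) u′) adj))

  isAutomorphism-product : IsAutomorphism 1 → ∀ ps → All Prime ps → ¬ 2 ∣ product ps → Coprime n (product ps) →
                           IsAutomorphism (product ps)
  isAutomorphism-product aut₁ []       _                 _   _   = aut₁
  isAutomorphism-product aut₁ (p ∷ ps) (p-prime ∷ primes) odd n⊥m =
    isAutomorphism-prime-* p-prime (odd ∘ λ 2∣p → ∣-trans 2∣p (m∣m*n (product ps)))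
      (coprime-∣ʳ n⊥m (m∣m*n (product ps))) (coprime-∣ʳ n⊥m (n∣m*n p))
      (isAutomorphism-product aut₁ ps primes (odd ∘ λ 2∣ps → ∣-trans 2∣ps (n∣m*n p)) (coprime-∣ʳ n⊥m (n∣m*n p)))

  isAutomorphism-odd : IsAutomorphism 1 → ∀ m → ¬ 2 ∣ m → Coprime n m → IsAutomorphism m
  isAutomorphism-odd aut₁ zero odd _ = ⊥-elim (odd (Data.Nat.Divisibility.divides 0 refl))
  isAutomorphism-odd aut₁ m@(suc _) odd n⊥m with factorise m
  ... | record { factors = ps ; isFactorisation = m≡Πps ; factorsPrime = primes } =
    subst IsAutomorphism (sym m≡Πps)
      (isAutomorphism-product aut₁ ps primes (subst (¬_ ∘ (2 ∣_)) m≡Πps odd) (subst (Coprime n) m≡Πps n⊥m))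

module Automorphism {n : ℕ} .{{_ : NonZero n}} {S : Pred (Fin n) 0ℓ} (S-sym : Symmetric S) (α : BAut S) where
  open import Data.Nat using (ℕ)
  open import Data.Nat.Divisibility using (_∣_)
  open import Data.Nat.Coprimality using (Coprime)
  open import Data.Bool using (true; false)
  open import Data.Fin.Subset using (Subset; ⁅_⁆) renaming (_∈_ to _∈ˢ_)
  open import Data.Fin.Subset.Properties using (x∈⁅x⁆; x∈⁅y⁆⇒x≡y)
  open import Data.List using (List; _∷_; map; _++_; allFin)
  open import Data.List.Membership.Propositional using () renaming (_∈_ to _∈ₗ_)
  open import Data.List.Membership.Propositional.Properties
    using (∈-map⁺; ∈-map⁻; ∈-++⁺ˡ; ∈-++⁺ʳ; ∈-++⁻; ∈-allFin)
  open import Data.List.Relation.Unary.Any using (here; there)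
  open import Data.Product using (_×_; _,_; proj₁; proj₂; ∃-syntax)
  open import Data.Sum using (_⊎_; inj₁; inj₂)
  open import Function using (_⇔_; mk⇔; Inverse)
  open import Function.Bundles using (Equivalence)
  open import Relation.Binary.PropositionalEquality
  open import Relation.Nullary using (¬_)
  open import Relation.Unary using (_∈_)
  open IntegersModulo
  open DoubleCover
  open BAut α using (perm; preserve; reflect)
  open Inverse perm using (from; strictlyInverseˡ; strictlyInverseʳ)

  private
    V : Set
    V = BVertex {n}

  allVertices : List V
  allVertices = map (_, false) (allFin n) ++ map (_, true) (allFin n)

  ∈-allVertices : ∀ u → u ∈ₗ allVertices
  ∈-allVertices (a , false) = ∈-++⁺ˡ (∈-map⁺ (_, false) (∈-allFin a))
  ∈-allVertices (a , true)  = ∈-++⁺ʳ (map (_, false) (allFin n)) (∈-map⁺ (_, true) (∈-allFin a))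

  label : V → V → Fin n
  label u w = proj₁ w -ₙ proj₁ u

  adj-⊕ : ∀ u {d} → d ∈ S → BAdj S u (u ⊕ d)
  adj-⊕ (a , b) {d} d∈S = refl , subst S (sym (xyx⁻¹≈y a d)) d∈S

  adj⇒⊕-label : ∀ {u w} → BAdj S u w → w ≡ u ⊕ label u w
  adj⇒⊕-label {a , b} {c , e} (e≡¬b , _) = cong₂ _,_ (sym (+ₙ-label a c)) e≡¬b
    where
      +ₙ-label : ∀ a c → a +ₙ (c -ₙ a) ≡ c
      +ₙ-label a c = trans (+ₙ-comm a (c -ₙ a)) (trans (+ₙ-assoc c (-ₙ a) a)
                       (trans (cong (c +ₙ_) (-ₙ-inverseˡ a)) (+ₙ-identityʳ c)))

  -- S need not be decidable, so the argument runs on the finite set T ⊆ S generated from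
  -- one label x₀ under negation and under transport of edge labels by α and α⁻¹.
  label-successors : Fin n → List (Fin n)
  label-successors d = (-ₙ d) ∷ map (λ u → label (apply α u) (apply α (u ⊕ d))) allVertices
                                ++ map (λ u → label (from u) (from (u ⊕ d))) allVertices

  label-successors⊆S : ∀ {d d′} → d ∈ S → d′ ∈ₗ label-successors d → d′ ∈ S
  label-successors⊆S d∈S (here refl) = S-sym _ d∈S
  label-successors⊆S {d} d∈S (there d′∈)
    with ∈-++⁻ (map (λ u → label (apply α u) (apply α (u ⊕ d))) allVertices) d′∈
  ... | inj₁ d′∈images with ∈-map⁻ _ d′∈images
  ...   | u , _ , refl = proj₂ (preserve u (u ⊕ d) (adj-⊕ u d∈S))
  label-successors⊆S {d} d∈S (there d′∈) | inj₂ d′∈preimages with ∈-map⁻ _ d′∈preimages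
  ...   | u , _ , refl = proj₂ (reflect (from u) (from (u ⊕ d))
                           (subst₂ (BAdj S) (sym (strictlyInverseˡ u)) (sym (strictlyInverseˡ (u ⊕ d))) (adj-⊕ u d∈S)))

  module LabelClosure (x₀ : Fin n) (x₀∈S : x₀ ∈ S) where
    open FiniteClosure label-successors

    T : Subset n
    T = closure ⁅ x₀ ⁆

    T⊆S : ∀ {x} → x ∈ˢ T → x ∈ S
    T⊆S = closure-least ⁅ x₀ ⁆ S (λ {x} x∈ → subst S (sym (x∈⁅y⁆⇒x≡y x₀ x∈)) x₀∈S) label-successors⊆S

    x₀∈T : x₀ ∈ˢ T
    x₀∈T = ⊆-closure ⁅ x₀ ⁆ (x∈⁅x⁆ x₀)

    -ₙ∈T : ∀ {x} → x ∈ˢ T → -ₙ x ∈ˢ T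
    -ₙ∈T x∈T = closure-closed ⁅ x₀ ⁆ x∈T (here refl)

    open ScaledCayley (elements T) (elements-unique T) perm public

    ∈L⇔∈T : ∀ {x} → x ∈ₗ elements T ⇔ x ∈ˢ T
    ∈L⇔∈T = ∈-elements T

    isAutomorphism₁ : IsAutomorphism 1
    isAutomorphism₁ u w = mk⇔ forward backward
      where
        forward : Adj 1 u w → Adj 1 (apply α u) (apply α w)
        forward (x , x∈L , refl) = d , Equivalence.from ∈L⇔∈T d∈T , (begin
          apply α (u ⊕ (1 ·ₙ x))       ≡⟨ cong (λ y → apply α (u ⊕ y)) (·ₙ-identityˡ x) ⟩
          apply α (u ⊕ x)              ≡⟨ adj⇒⊕-label (preserve u (u ⊕ x) (adj-⊕ u (T⊆S x∈T))) ⟩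
          apply α u ⊕ d                ≡⟨ cong (apply α u ⊕_) (sym (·ₙ-identityˡ d)) ⟩
          apply α u ⊕ (1 ·ₙ d)         ∎)
          where
            open ≡-Reasoning
            x∈T : x ∈ˢ T
            x∈T = Equivalence.to ∈L⇔∈T x∈L
            d : Fin n
            d = label (apply α u) (apply α (u ⊕ x))
            d∈T : d ∈ˢ T
            d∈T = closure-closed ⁅ x₀ ⁆ x∈T (there (∈-++⁺ˡ (∈-map⁺ _ (∈-allVertices u))))
        backward : Adj 1 (apply α u) (apply α w) → Adj 1 u w
        backward (x , x∈L , αw≡) =
          label u w , Equivalence.from ∈L⇔∈T d∈T , trans w≡u⊕d (cong (u ⊕_) (sym (·ₙ-identityˡ _)))
          where
            x∈T : x ∈ˢ T
            x∈T = Equivalence.to ∈L⇔∈T x∈L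
            αw≡αu⊕x : apply α w ≡ apply α u ⊕ x
            αw≡αu⊕x = trans αw≡ (cong (apply α u ⊕_) (·ₙ-identityˡ x))
            w≡u⊕d : w ≡ u ⊕ label u w
            w≡u⊕d = adj⇒⊕-label
              (reflect u w (subst (BAdj S (apply α u)) (sym αw≡αu⊕x) (adj-⊕ (apply α u) (T⊆S x∈T))))
            label≡ : label (from (apply α u)) (from (apply α u ⊕ x)) ≡ label u w
            label≡ = cong₂ label (strictlyInverseʳ u) (trans (cong from (sym αw≡αu⊕x)) (strictlyInverseʳ w))
            d∈T : label u w ∈ˢ T
            d∈T = subst (_∈ˢ T) label≡ (closure-closed ⁅ x₀ ⁆ x∈T
                    (there (∈-++⁺ʳ (map (λ u → label (apply α u) (apply α (u ⊕ x))) allVertices)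
                                   (∈-map⁺ _ (∈-allVertices (apply α u))))))

    ∈S-of-scaled-t-edge : ∀ {m} → ¬ 2 ∣ m → Coprime n m → ∀ {s t} → m ·ₙ x₀ ≡ s →
                          (∃[ u ] ∃[ v ] (IsSEdge S s u v × IsSEdge S t (apply α u) (apply α v))) →
                          ∀ {y} → m ·ₙ y ≡ t → y ∈ S
    ∈S-of-scaled-t-edge {m} m-odd n⊥m {s} {t} mx₀≡s (u , v , (_ , s-step) , (_ , t-step)) {y} my≡t
      with Equivalence.to (isAutomorphism-odd isAutomorphism₁ m m-odd n⊥m u v) (scaled-edge s-step)
      where
        scaled-edge : (v ≡ u ⊕ s) ⊎ (v ≡ u ⊖ s) → Adj m u v
        scaled-edge (inj₁ v≡u⊕s) = x₀ , Equivalence.from ∈L⇔∈T x₀∈T , trans v≡u⊕s (cong (u ⊕_) (sym mx₀≡s))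
        scaled-edge (inj₂ v≡u⊖s) = -ₙ x₀ , Equivalence.from ∈L⇔∈T (-ₙ∈T x₀∈T) ,
          trans v≡u⊖s (cong (u ⊕_) (sym (trans (·ₙ-neg m x₀) (cong -ₙ_ mx₀≡s))))
    ... | x , x∈L , αv≡αu⊕mx = T⊆S (image-label t-step)
      where
        x∈T : x ∈ˢ T
        x∈T = Equivalence.to ∈L⇔∈T x∈L
        image-label : (apply α v ≡ apply α u ⊕ t) ⊎ (apply α v ≡ apply α u ⊖ t) → y ∈ˢ T
        image-label (inj₁ αv≡αu⊕t) = subst (_∈ˢ T) (·ₙ-injective n⊥m x y mx≡my) x∈T
          where
            mx≡my : m ·ₙ x ≡ m ·ₙ y
            mx≡my = trans (⊕-cancelˡ (apply α u) _ _ (trans (sym αv≡αu⊕mx) αv≡αu⊕t)) (sym my≡t)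
        image-label (inj₂ αv≡αu⊖t) = subst (_∈ˢ T) (trans (cong -ₙ_ x≡-y) (⁻¹-involutive y)) (-ₙ∈T x∈T)
          where
            x≡-y : x ≡ -ₙ y
            x≡-y = ·ₙ-injective n⊥m x (-ₙ y)
                     (trans (⊕-cancelˡ (apply α u) _ _ (trans (sym αv≡αu⊕mx) αv≡αu⊖t))
                            (sym (trans (·ₙ-neg m y) (cong -ₙ_ my≡t))))

module Generators {n : ℕ} .{{_ : NonZero n}} where
  open import Data.Nat hiding (_^_)
  open import Data.Nat.Properties
  open import Data.Nat.Divisibility
  open import Data.Nat.DivMod
  open import Data.Nat.GCD using (gcd)
  open import Data.Nat.Coprimality using (Coprime; gcd≡1⇒coprime; 1-coprimeTo)
  import Data.Nat.Coprimality as Coprimality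
  open import Data.Product using (_×_; _,_; ∃; ∃-syntax)
  open import Relation.Binary.PropositionalEquality
  open import Relation.Unary using (_∈_)
  open import Relation.Nullary using (¬_)
  open Arithmetic
  open IntegersModulo

  multiple-annihilated : ∀ {t : Fin n} {d} → IsOrder t d → ∀ a → d ·ₙ (a ·ₙ t) ≡ 0ₙ
  multiple-annihilated {t} {d} (_ , dt≡0 , _) a = begin
    d ·ₙ (a ·ₙ t) ≡⟨ ·ₙ-assoc d a t ⟩
    (d * a) ·ₙ t  ≡⟨ cong (_·ₙ t) (*-comm d a) ⟩
    (a * d) ·ₙ t  ≡⟨ sym (·ₙ-assoc a d t) ⟩
    a ·ₙ (d ·ₙ t) ≡⟨ cong (a ·ₙ_) dt≡0 ⟩
    a ·ₙ 0ₙ       ≡⟨ ·ₙ-zeroʳ a ⟩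
    0ₙ            ∎
    where open ≡-Reasoning

  -- t = (b a)·t forces b a ≡ 1 modulo the order of t.
  generator-coefficient-coprime : ∀ {t : Fin n} {d} → IsOrder t d → ∀ a b → t ≡ b ·ₙ (a ·ₙ t) → Coprime b d
  generator-coefficient-coprime {t} {d} o a b t≡bat {i} (i∣b , i∣d) = ∣1⇒≡1 (i∣1 (b * a) refl)
    where
      [ba]t≡1t : (b * a) ·ₙ t ≡ 1 ·ₙ t
      [ba]t≡1t = trans (sym (·ₙ-assoc b a t)) (trans (sym t≡bat) (sym (·ₙ-identityˡ t)))
      i∣1 : ∀ k → b * a ≡ k → i ∣ 1
      i∣1 zero    ba≡0   = ∣-trans i∣d (order-∣-∸ o z≤n (sym (subst (λ j → j ·ₙ t ≡ 1 ·ₙ t) ba≡0 [ba]t≡1t)))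
      i∣1 (suc k) ba≡1+k = ∣m+n∣m⇒∣n (subst (i ∣_) (trans ba≡1+k (+-comm 1 k)) (∣m⇒∣m*n a i∣b))
        (∣-trans i∣d (order-∣-∸ o (s≤s z≤n) (subst (λ j → j ·ₙ t ≡ 1 ·ₙ t) ba≡1+k [ba]t≡1t)))

  scale-to-generator : ∀ {t y : Fin n} {d} .{{_ : NonZero d}} → IsOrder t d → ∀ {a b} →
                       y ≡ a ·ₙ t → t ≡ b ·ₙ y → ∀ {m} → m % d ≡ b % d → m ·ₙ y ≡ t
  scale-to-generator {y = y} {d} o {a} y≡at t≡by m≡b =
    trans (·ₙ-cong-mod d y (subst (λ z → d ·ₙ z ≡ 0ₙ) (sym y≡at) (multiple-annihilated o a)) m≡b) (sym t≡by)

  odd-unit-onto-generator : ∀ {t y : Fin n} → Generates y t → ∃ λ m → ¬ 2 ∣ m × Coprime n m × m ·ₙ y ≡ t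
  odd-unit-onto-generator {t} {y} ((a , y≡at) , (b , t≡by)) with order-exists t
  ... | d , o@(0<d , _) =
    lifted (odd-coprime-lift n b d (order-∣n o) (generator-coefficient-coprime o a b (trans t≡by (cong (b ·ₙ_) y≡at))))
    where
      instance
        d≢0 : NonZero d
        d≢0 = >-nonZero 0<d
      lifted : (∃ λ m → m % d ≡ b % d × ¬ 2 ∣ m × Coprime n m) → ∃ λ m → ¬ 2 ∣ m × Coprime n m × m ·ₙ y ≡ t
      lifted (m , m≡b , m-odd , n⊥m) = m , m-odd , n⊥m , scale-to-generator o {a} {b} y≡at t≡by m≡b

  -- By the Chinese remainder theorem m can be taken ≡ 1 modulo the order of s.
  odd-unit-fixing-onto-generator : ∀ {s t y : Fin n} {ks kt} → IsOrder s ks → IsOrder t kt → gcd ks kt ≡ 1 →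
                                   Generates y t → ∃ λ m → ¬ 2 ∣ m × Coprime n m × m ·ₙ s ≡ s × m ·ₙ y ≡ t
  odd-unit-fixing-onto-generator {s} {t} {y} {ks} {kt} os@(0<ks , ks·s≡0 , _) ot@(0<kt , _) gcd≡1 ((a , y≡at) , (b , t≡by)) =
    lifted (chinese-remainder 1 b ks kt ks⊥kt)
    where
      instance
        ks≢0 : NonZero ks
        ks≢0 = >-nonZero 0<ks
        kt≢0 : NonZero kt
        kt≢0 = >-nonZero 0<kt
        ks*kt≢0 : NonZero (ks * kt)
        ks*kt≢0 = m*n≢0 ks kt
      ks⊥kt : Coprime ks kt
      ks⊥kt = gcd≡1⇒coprime gcd≡1
      b⊥kt : Coprime b kt
      b⊥kt = generator-coefficient-coprime ot a b (trans t≡by (cong (b ·ₙ_) y≡at))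
      lifted : (∃ λ c → c % ks ≡ 1 % ks × c % kt ≡ b % kt) →
               ∃ λ m → ¬ 2 ∣ m × Coprime n m × m ·ₙ s ≡ s × m ·ₙ y ≡ t
      lifted (c , c≡1 , c≡b)
        with odd-coprime-lift n c (ks * kt) (coprime-∣-* ks⊥kt (order-∣n os) (order-∣n ot))
               (coprime-*ʳ (coprime-%ˡ c≡1 (1-coprimeTo ks)) (coprime-%ˡ c≡b b⊥kt))
      ... | m , m≡c , m-odd , n⊥m =
        m , m-odd , n⊥m ,
        trans (·ₙ-cong-mod ks s ks·s≡0 (trans (%≡%-∣ {d = ks} {N = ks * kt} (m∣m*n kt) m≡c) c≡1)) (·ₙ-identityˡ s) ,
        scale-to-generator {d = kt} ot {a} {b} y≡at t≡by (trans (%≡%-∣ {d = kt} {N = ks * kt} (n∣m*n ks) m≡c) c≡b)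

  module _ {S : Pred (Fin n) 0ℓ} (S-sym : Symmetric S) (α : BAut S) {s t : Fin n}
           (edge : ∃[ u ] ∃[ v ] (IsSEdge S s u v × IsSEdge S t (apply α u) (apply α v))) where
    open Automorphism.LabelClosure S-sym α using (∈S-of-scaled-t-edge)

    all-generators-of-t-from-s : ContainsAllGenerators S s → ContainsAllGenerators S t
    all-generators-of-t-from-s all-s y y-generates = via-unit (odd-unit-onto-generator y-generates)
      where
        via-unit : (∃ λ m → ¬ 2 ∣ m × Coprime n m × m ·ₙ y ≡ t) → y ∈ S
        via-unit (m , m-odd , n⊥m , my≡t) = via-inverse (mod-inverse m n (Coprimality.sym n⊥m))
          where
            via-inverse : (∃ λ w → (m * w) % n ≡ 1 % n) → y ∈ S
            via-inverse (w , mw≡1) =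
              ∈S-of-scaled-t-edge (w ·ₙ s) (all-s (w ·ₙ s) ((w , refl) , (m , sym m·ws≡s))) m-odd n⊥m m·ws≡s edge my≡t
              where
                m·ws≡s : m ·ₙ (w ·ₙ s) ≡ s
                m·ws≡s = trans (·ₙ-assoc m w s) (trans (·ₙ-cong-mod n s (n·ₙ≡0ₙ s) mw≡1) (·ₙ-identityˡ s))

    all-generators-of-t-from-coprime-orders : s ∈ S → (∃[ ks ] ∃[ kt ] (IsOrder s ks × IsOrder t kt × gcd ks kt ≡ 1)) →
                                              ContainsAllGenerators S t
    all-generators-of-t-from-coprime-orders s∈S (ks , kt , os , ot , gcd≡1) y y-generates =
      via-unit (odd-unit-fixing-onto-generator os ot gcd≡1 y-generates)
      where
        via-unit : (∃ λ m → ¬ 2 ∣ m × Coprime n m × m ·ₙ s ≡ s × m ·ₙ y ≡ t) → y ∈ S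
        via-unit (m , m-odd , n⊥m , ms≡s , my≡t) = ∈S-of-scaled-t-edge s s∈S m-odd n⊥m ms≡s edge my≡t

open import Data.Nat.GCD using (gcd)
open import Data.Product using (_×_; ∃-syntax)
open import Data.Sum using (_⊎_; inj₁; inj₂)
open import Relation.Unary using (_∈_)

corollary4p6 : (n : ℕ) .{{_ : NonZero n}} (S : Pred (Fin n) 0ℓ) → Symmetric S →
    (α : BAut S) (s t : Fin n) → s ∈ S → t ∈ S →
    (∃[ u ] ∃[ v ] (IsSEdge S s u v × IsSEdge S t (apply α u) (apply α v))) →
    ((∃[ ks ] ∃[ kt ] (IsOrder s ks × IsOrder t kt × gcd ks kt ≡ 1)) ⊎ ContainsAllGenerators S s) →
    ContainsAllGenerators S t
corollary4p6 n S S-sym α s t s∈S _ edge (inj₁ coprime-orders) =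
  Generators.all-generators-of-t-from-coprime-orders S-sym α edge s∈S coprime-orders
corollary4p6 n S S-sym α s t _ _ edge (inj₂ generators-of-s) =
  Generators.all-generators-of-t-from-s S-sym α edge generators-of-s
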